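{- For any $d>0$, on pixel structures of $d$-pictures, every sentence of $\mathrm{ESO}(\mathrm{arity}\ 1)$ is equivalent to a sentence of $\mathrm{ESO}(\forall^1,\mathrm{arity}\ 1)$: for every finite alphabet $\Sigma$ and every sentence $\Phi\in\mathrm{ESO}(\mathrm{arity}\ 1)$ over the pixel signature, there is $\Phi'\in\mathrm{ESO}(\forall^1,\mathrm{arity}\ 1)$ such that for every $d$-picture $p$ over $\Sigma$, $\mathrm{pixel}^d(p)\models\Phi$ iff $\mathrm{pixel}^d(p)\models\Phi'$.
   Context: For $n\ge1$ let $[n]=\{1,\dots,n\}$. A $d$-picture over $\Sigma$ is a map $p:[n]^d\to\Sigma$. The pixel structure $\mathrm{pixel}^d(p)$ has domain $[n]^d$, unary relations $Q_s=\{a:p(a)=s\}$ ($s\in\Sigma$), $\min_i=\{a:a_i=1\}$, $\max_i=\{a:a_i=n\}$ ($i\in[d]$), and unary functions $\mathrm{succ}_i$ ($i\in[d]$), where $\mathrm{succ}_i(a)$ equals $a$ except its $i$-th coordinate is $a_i+1$ if $a_i<n$ and $1$ if $a_i=n$. $\mathrm{ESO}(\forall^k,\mathrm{arity}\ \ell)$ is the set of sentences $\exists R_1\dots\exists R_m\,\forall x_1\dots\forall x_k\,\theta$ with $R_j$ relation symbols of arity at most $\ell$ and $\theta$ quantifier-free over the given signature plus the $R_j$; $\mathrm{ESO}(\mathrm{arity}\ \ell)=\bigcup_{k>0}\mathrm{ESO}(\forall^k,\mathrm{arity}\ \ell)$. -}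

module Defs where

open import Data.Nat as ℕ using (ℕ; zero; suc; _≤_; _<_; _<?_; s≤s)
open import Data.Fin as Fin using (Fin; toℕ; fromℕ; fromℕ<)
import Data.Fin.Properties as FinP
open import Data.Vec using (Vec; lookup; updateAt; map)
import Data.Vec.Properties as VecP
open import Data.Vec.Relation.Unary.All using (All)
open import Data.Bool using (Bool; true; false; not; _∧_; _∨_)
open import Data.Product using (Σ; _×_; _,_)
open import Relation.Nullary using (yes; no)
open import Relation.Nullary.Decidable using (⌊_⌋)
open import Relation.Binary.PropositionalEquality using (_≡_)

-- [n] with n = suc m is represented by Fin (suc m); the element i : Fin (suc m)
-- stands for the number toℕ i + 1.  A point of [n]^d is a vector of d coordinates.
Point : ℕ → ℕ → Set
Point d m = Vec (Fin (suc m)) d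

Picture : ℕ → ℕ → ℕ → Set
Picture d s m = Point d m → Fin s

csuc : ∀ {m} → Fin (suc m) → Fin (suc m)
csuc {m} a with toℕ a <? m
... | yes a<m = fromℕ< (s≤s a<m)
... | no _    = Fin.zero

succAt : ∀ {d m} → Fin d → Point d m → Point d m
succAt i a = updateAt a i csuc

data Term (d k : ℕ) : Set where
  var  : Fin k → Term d k
  succ : Fin d → Term d k → Term d k

data QF (d s : ℕ) {r : ℕ} (ar : Vec ℕ r) (k : ℕ) : Set where
  Qs   : Fin s → Term d k → QF d s ar k
  minA : Fin d → Term d k → QF d s ar k
  maxA : Fin d → Term d k → QF d s ar k
  eqA  : Term d k → Term d k → QF d s ar k
  relA : (j : Fin r) → Vec (Term d k) (lookup ar j) → QF d s ar k
  ¬'   : QF d s ar k → QF d s ar k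
  _∧'_ : QF d s ar k → QF d s ar k → QF d s ar k
  _∨'_ : QF d s ar k → QF d s ar k → QF d s ar k

-- A sentence  ∃R_1…∃R_r ∀x_1…∀x_k θ  of ESO(∀^k, arity ℓ)
record ESO∀ (d s k ℓ : ℕ) : Set where
  constructor eso
  field
    r      : ℕ
    ar     : Vec ℕ r
    arity≤ : All (_≤ ℓ) ar
    matrix : QF d s ar k

ESO : ℕ → ℕ → ℕ → Set
ESO d s ℓ = Σ ℕ λ k → (0 < k) × ESO∀ d s k ℓ

module _ {d s m : ℕ} (p : Picture d s m) where

  RelInterp : ∀ {r} → Vec ℕ r → Set
  RelInterp {r} ar = (j : Fin r) → Vec (Point d m) (lookup ar j) → Bool

  evalT : ∀ {k} → (Fin k → Point d m) → Term d k → Point d m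
  evalT ρ (var x)    = ρ x
  evalT ρ (succ i t) = succAt i (evalT ρ t)

  evalF : ∀ {r} {ar : Vec ℕ r} {k} → RelInterp ar → (Fin k → Point d m)
        → QF d s ar k → Bool
  evalF R ρ (Qs c t)    = ⌊ p (evalT ρ t) FinP.≟ c ⌋
  evalF R ρ (minA i t)  = ⌊ lookup (evalT ρ t) i FinP.≟ Fin.zero ⌋
  evalF R ρ (maxA i t)  = ⌊ lookup (evalT ρ t) i FinP.≟ fromℕ m ⌋
  evalF R ρ (eqA t u)   = ⌊ VecP.≡-dec FinP._≟_ (evalT ρ t) (evalT ρ u) ⌋
  evalF R ρ (relA j ts) = R j (map (evalT ρ) ts)
  evalF R ρ (¬' φ)      = not (evalF R ρ φ)
  evalF R ρ (φ ∧' ψ)    = evalF R ρ φ ∧ evalF R ρ ψ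
  evalF R ρ (φ ∨' ψ)    = evalF R ρ φ ∨ evalF R ρ ψ

  _⊨∀_ : ∀ {k ℓ} → ESO∀ d s k ℓ → Set
  _⊨∀_ {k} (eso r ar _ θ) =
    Σ (RelInterp ar) λ R → (ρ : Fin k → Point d m) → evalF R ρ θ ≡ true

  _⊨_ : ∀ {ℓ} → ESO d s ℓ → Set
  _⊨_ (k , _ , Φ) = _⊨∀_ Φ

-- Eliminate the universal variables one at a time, introducing only unary
-- and nullary relations. A term is one variable moved by axis successors,
-- i.e. a bijection of the torus applied to it, so in ∀y ∀x⃗ θ every atom
-- mixing y with x⃗ is a crossing equation a(y) = b(x_i). The assignments
-- satisfying one are parametrised by x⃗ alone. On the others, θ depends only
-- on x⃗ and on the type of y (the truth values of the atoms about y), so it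
-- suffices that the residual formula for a type hold whenever some y of that
-- type satisfies none of the E crossing equations. A type with more than E
-- points always has such a y. A type with at most E points is listed in E
-- unary slots, each forced to be a singleton by unary hyperplane and sweep
-- relations along every axis, and the point c of a slot satisfies equation
-- a(y) = b(x_i) iff b(x_i) lies in the unary relation a(slot).

module Submission where

open import Defs

open import Data.Bool using (Bool; true; false; T; if_then_else_)
open import Data.Empty using (⊥; ⊥-elim)
open import Data.Fin as Fin using (Fin; zero; suc; toℕ; fromℕ; fromℕ<; _↑ˡ_; _↑ʳ_; splitAt)
import Data.Fin.Properties as Finₚ
open import Data.List as List using (List; []; _∷_; allFin)
open import Data.List.Membership.Propositional using (_∈_)
open import Data.List.Membership.Propositional.Properties
  using (∈-allFin; ∈-cartesianProductWith⁺; ∈-filter⁺; ∈-filter⁻; ∈-deduplicate⁺; ∈-deduplicate⁻)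
import Data.List.Relation.Unary.All as ListAll
open import Data.List.Relation.Unary.Any using (here; there)
open import Data.List.Relation.Unary.Unique.Propositional using (Unique; []; _∷_)
open import Data.List.Relation.Unary.Unique.DecPropositional.Properties using (deduplicate-!)
open import Data.Maybe using (Maybe; just; nothing; is-nothing)
import Data.Maybe.Properties as Maybeₚ
open import Data.Nat as ℕ using (ℕ; zero; suc; _≤_; _<_; _+_; _∸_; z≤n; s≤s; _<?_; _≤?_)
import Data.Nat.Properties as ℕₚ
open import Data.Nat.GeneralisedArithmetic using (fold; fold-+)
open import Data.Product using (Σ; _×_; _,_; proj₁; proj₂; ∃-syntax)
open import Data.Product.Function.NonDependent.Propositional using (_×-↔_; _×-⇔_)
open import Data.Sum as Sum using (_⊎_; inj₁; inj₂; [_,_]′)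
open import Data.Sum.Function.Propositional using (_⊎-↔_; _⊎-⇔_)
open import Data.Unit using (⊤; tt)
open import Data.Vec using (Vec; []; _∷_; lookup; updateAt; map; replicate; _++_; cast; _[_]≔_; tabulate)
open import Data.Vec.Functional as Env using ()
import Data.Vec.Functional.Properties as Envₚ
import Data.Vec.Properties as Vecₚ
open import Data.Vec.Relation.Unary.All using (All; []; _∷_)
import Data.Vec.Relation.Unary.All.Properties as Allₚ
open import Function using (_∘_; id; const)
open import Function.Bundles using (_⇔_; _↔_; Inverse; mk⇔; Equivalence)
open import Function.Construct.Composition using (_⇔-∘_)
open import Function.Construct.Identity using (⇔-id)
open import Function.Properties.Inverse using (↔-refl; ↔-trans)
open import Function.Related.TypeIsomorphisms using (→-cong-⇔; ¬-cong-⇔)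
open import Relation.Binary.Definitions using (tri<; tri≈; tri>; DecidableEquality)
open import Relation.Binary.PropositionalEquality
open import Relation.Nullary using (¬_; Dec; yes; no; contradiction; ¬?; _×-dec_; _⊎-dec_; _→-dec_)
open import Relation.Nullary.Decidable using (T?; ⌊_⌋; toWitness; fromWitness)
open import Relation.Nullary.Reflects
  using (Reflects; ofʸ; ofⁿ; T-reflects; ¬-reflects; _×-reflects_; _⊎-reflects_; _→-reflects_)

module _ {m : ℕ} where

  csuc-toℕ : (a : Fin (suc m)) → toℕ a < m → toℕ (csuc a) ≡ suc (toℕ a)
  csuc-toℕ a a<m with toℕ a <? m
  ... | yes a<m′ = Finₚ.toℕ-fromℕ< (s≤s a<m′)
  ... | no a≮m = contradiction a<m a≮m

  csuc-last : (a : Fin (suc m)) → toℕ a ≡ m → csuc a ≡ zero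
  csuc-last a a≡m with toℕ a <? m
  ... | yes a<m = contradiction a≡m (ℕₚ.<⇒≢ a<m)
  ... | no _ = refl

  ≢fromℕ⇒toℕ< : (a : Fin (suc m)) → a ≢ fromℕ m → toℕ a < m
  ≢fromℕ⇒toℕ< a a≢last with ℕₚ.m≤n⇒m<n∨m≡n (Finₚ.toℕ≤pred[n] a)
  ... | inj₁ a<m = a<m
  ... | inj₂ a≡m = contradiction (Finₚ.toℕ-injective (trans a≡m (sym (Finₚ.toℕ-fromℕ m)))) a≢last

  toℕ-fold-csuc : (a : Fin (suc m)) (t : ℕ) → toℕ a + t ≤ m →
                  toℕ (fold a csuc t) ≡ toℕ a + t
  toℕ-fold-csuc a zero _ = sym (ℕₚ.+-identityʳ (toℕ a))
  toℕ-fold-csuc a (suc t) a+1+t≤m = begin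
    toℕ (csuc (fold a csuc t)) ≡⟨ csuc-toℕ _ (subst (_< m) (sym ih) a+t<m) ⟩
    suc (toℕ (fold a csuc t))  ≡⟨ cong suc ih ⟩
    suc (toℕ a + t)            ≡⟨ ℕₚ.+-suc (toℕ a) t ⟨
    toℕ a + suc t              ∎
    where
    open ≡-Reasoning
    a+t<m : toℕ a + t < m
    a+t<m = subst (_≤ m) (ℕₚ.+-suc (toℕ a) t) a+1+t≤m
    ih = toℕ-fold-csuc a t (ℕₚ.<⇒≤ a+t<m)

  fold-csuc-from-zero : (b : Fin (suc m)) → fold zero csuc (toℕ b) ≡ b
  fold-csuc-from-zero b = Finₚ.toℕ-injective (toℕ-fold-csuc zero (toℕ b) (Finₚ.toℕ≤pred[n] b))

  fold-csuc-to-zero : (a : Fin (suc m)) → fold a csuc (suc (m ∸ toℕ a)) ≡ zero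
  fold-csuc-to-zero a =
    csuc-last _ (trans (toℕ-fold-csuc a (m ∸ toℕ a) (ℕₚ.≤-reflexive a+[m∸a]≡m)) a+[m∸a]≡m)
    where a+[m∸a]≡m = ℕₚ.m+[n∸m]≡n (Finₚ.toℕ≤pred[n] a)

  -- The orbit of a passes through zero.
  csuc-orbit : (a b : Fin (suc m)) → ∃[ t ] fold a csuc t ≡ b
  csuc-orbit a b = toℕ b + suc (m ∸ toℕ a) , (begin
    fold a csuc (toℕ b + suc (m ∸ toℕ a))             ≡⟨ fold-+ a csuc (toℕ b) ⟩
    fold (fold a csuc (suc (m ∸ toℕ a))) csuc (toℕ b) ≡⟨ cong (λ z → fold z csuc (toℕ b))
                                                              (fold-csuc-to-zero a) ⟩
    fold zero csuc (toℕ b)                            ≡⟨ fold-csuc-from-zero b ⟩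
    b                                                 ∎)
    where open ≡-Reasoning

  csuc-period : (a : Fin (suc m)) → fold a csuc (suc m) ≡ a
  csuc-period a = trans (cong (fold a csuc) 1+m≡a+1+[m∸a]) (proj₂ (csuc-orbit a a))
    where
    1+m≡a+1+[m∸a] : suc m ≡ toℕ a + suc (m ∸ toℕ a)
    1+m≡a+1+[m∸a] = trans (cong suc (sym (ℕₚ.m+[n∸m]≡n (Finₚ.toℕ≤pred[n] a))))
                          (sym (ℕₚ.+-suc (toℕ a) _))

  cpred : Fin (suc m) → Fin (suc m)
  cpred a = fold a csuc m

  csuc-cpred : (a : Fin (suc m)) → csuc (cpred a) ≡ a
  csuc-cpred = csuc-period

  cpred-csuc : (a : Fin (suc m)) → cpred (csuc a) ≡ a
  cpred-csuc a = trans (fold-shift m) (csuc-period a)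
    where
    fold-shift : ∀ t → fold (csuc a) csuc t ≡ csuc (fold a csuc t)
    fold-shift zero = refl
    fold-shift (suc t) = cong csuc (fold-shift t)

module _ {d m : ℕ} where

  _≟ᵖ_ : (x y : Point d m) → Dec (x ≡ y)
  _≟ᵖ_ = Vecₚ.≡-dec Finₚ._≟_

  lookup-≗⇒≡ : {x y : Point d m} → (∀ i → lookup x i ≡ lookup y i) → x ≡ y
  lookup-≗⇒≡ {x} {y} eq = begin
    x                 ≡⟨ Vecₚ.tabulate∘lookup x ⟨
    tabulate (lookup x) ≡⟨ Vecₚ.tabulate-cong eq ⟩
    tabulate (lookup y) ≡⟨ Vecₚ.tabulate∘lookup y ⟩
    y                 ∎
    where open ≡-Reasoning

  succAt-comm : (i j : Fin d) (x : Point d m) → succAt i (succAt j x) ≡ succAt j (succAt i x)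
  succAt-comm i j x with i Finₚ.≟ j
  ... | yes refl = refl
  ... | no i≢j = Vecₚ.updateAt-commutes i j i≢j x

  predAt : Fin d → Point d m → Point d m
  predAt i x = updateAt x i cpred

  predAt-succAt : (i : Fin d) (x : Point d m) → predAt i (succAt i x) ≡ x
  predAt-succAt i x = trans (Vecₚ.updateAt-updateAt i x) (Vecₚ.updateAt-id-local i x (cpred-csuc _))

  succAt-predAt : (i : Fin d) (x : Point d m) → succAt i (predAt i x) ≡ x
  succAt-predAt i x = trans (Vecₚ.updateAt-updateAt i x) (Vecₚ.updateAt-id-local i x (csuc-cpred _))

  fold-succAt : (i : Fin d) (x : Point d m) (t : ℕ) →
                fold x (succAt i) t ≡ updateAt x i (λ a → fold a csuc t)
  fold-succAt i x zero = sym (Vecₚ.updateAt-id i x)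
  fold-succAt i x (suc t) = trans (cong (succAt i) (fold-succAt i x t)) (Vecₚ.updateAt-updateAt i x)

-- Terms denote bijections

Env : ℕ → ℕ → ℕ → Set
Env d m k = Fin k → Point d m

module _ {d k : ℕ} where

  root : Term d k → Fin k
  root (var x) = x
  root (succ _ t) = root t

  module _ {m : ℕ} where

    ⟦_⟧ᵗ : Term d k → Point d m → Point d m
    ⟦ var _ ⟧ᵗ a = a
    ⟦ succ i t ⟧ᵗ a = succAt i (⟦ t ⟧ᵗ a)

    ⟦_⟧ᵗ⁻¹ : Term d k → Point d m → Point d m
    ⟦ var _ ⟧ᵗ⁻¹ a = a
    ⟦ succ i t ⟧ᵗ⁻¹ a = ⟦ t ⟧ᵗ⁻¹ (predAt i a)

    ⟦⟧ᵗ-⟦⟧ᵗ⁻¹ : (t : Term d k) (a : Point d m) → ⟦ t ⟧ᵗ (⟦ t ⟧ᵗ⁻¹ a) ≡ a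
    ⟦⟧ᵗ-⟦⟧ᵗ⁻¹ (var _) a = refl
    ⟦⟧ᵗ-⟦⟧ᵗ⁻¹ (succ i t) a = trans (cong (succAt i) (⟦⟧ᵗ-⟦⟧ᵗ⁻¹ t (predAt i a))) (succAt-predAt i a)

    ⟦⟧ᵗ⁻¹-⟦⟧ᵗ : (t : Term d k) (a : Point d m) → ⟦ t ⟧ᵗ⁻¹ (⟦ t ⟧ᵗ a) ≡ a
    ⟦⟧ᵗ⁻¹-⟦⟧ᵗ (var _) a = refl
    ⟦⟧ᵗ⁻¹-⟦⟧ᵗ (succ i t) a = trans (cong ⟦ t ⟧ᵗ⁻¹ (predAt-succAt i (⟦ t ⟧ᵗ a))) (⟦⟧ᵗ⁻¹-⟦⟧ᵗ t a)

    ⟦⟧ᵗ-injective : (t : Term d k) {a b : Point d m} → ⟦ t ⟧ᵗ a ≡ ⟦ t ⟧ᵗ b → a ≡ b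
    ⟦⟧ᵗ-injective t {a} {b} eq = begin
      a                   ≡⟨ ⟦⟧ᵗ⁻¹-⟦⟧ᵗ t a ⟨
      ⟦ t ⟧ᵗ⁻¹ (⟦ t ⟧ᵗ a) ≡⟨ cong ⟦ t ⟧ᵗ⁻¹ eq ⟩
      ⟦ t ⟧ᵗ⁻¹ (⟦ t ⟧ᵗ b) ≡⟨ ⟦⟧ᵗ⁻¹-⟦⟧ᵗ t b ⟩
      b                   ∎
      where open ≡-Reasoning

    evalT-⟦⟧ᵗ : ∀ {s} (p : Picture d s m) (ρ : Env d m k) (t : Term d k) →
                evalT p ρ t ≡ ⟦ t ⟧ᵗ (ρ (root t))
    evalT-⟦⟧ᵗ p ρ (var _) = refl
    evalT-⟦⟧ᵗ p ρ (succ i t) = cong (succAt i) (evalT-⟦⟧ᵗ p ρ t)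

    evalT-const-⟦⟧ᵗ⁻¹ : ∀ {s} (p : Picture d s m) {c w} (t : Term d k) →
                        evalT p (const c) t ≡ w → c ≡ ⟦ t ⟧ᵗ⁻¹ w
    evalT-const-⟦⟧ᵗ⁻¹ p {c} t t≡w =
      trans (sym (⟦⟧ᵗ⁻¹-⟦⟧ᵗ t c)) (cong ⟦ t ⟧ᵗ⁻¹ (trans (sym (evalT-⟦⟧ᵗ p _ t)) t≡w))

succAt-⟦⟧ᵗ : ∀ {d k m} (i : Fin d) (u : Term d k) (a : Point d m) →
             succAt i (⟦ u ⟧ᵗ a) ≡ ⟦ u ⟧ᵗ (succAt i a)
succAt-⟦⟧ᵗ i (var _) a = refl
succAt-⟦⟧ᵗ i (succ j u) a = trans (succAt-comm i j _) (cong (succAt j) (succAt-⟦⟧ᵗ i u a))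

⟦⟧ᵗ-comm : ∀ {d k l m} (t : Term d k) (u : Term d l) (a : Point d m) →
           ⟦ t ⟧ᵗ (⟦ u ⟧ᵗ a) ≡ ⟦ u ⟧ᵗ (⟦ t ⟧ᵗ a)
⟦⟧ᵗ-comm (var _) u a = refl
⟦⟧ᵗ-comm (succ i t) u a = trans (cong (succAt i) (⟦⟧ᵗ-comm t u a)) (succAt-⟦⟧ᵗ i u (⟦ t ⟧ᵗ a))

infix  10 _≐_
infix  9 ¬ᶠ_
infixr 8 _∧ᶠ_
infixr 7 _∨ᶠ_
infixr 6 _⇒ᶠ_

data Formula (d s : ℕ) (U N : Set) (k : ℕ) : Set where
  pixel          : Fin s → Term d k → Formula d s U N k
  atMin atMax    : Fin d → Term d k → Formula d s U N k
  _≐_            : Term d k → Term d k → Formula d s U N k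
  unary          : U → Term d k → Formula d s U N k
  nullary        : N → Formula d s U N k
  ⊤ᶠ             : Formula d s U N k
  ¬ᶠ_            : Formula d s U N k → Formula d s U N k
  _∧ᶠ_ _∨ᶠ_ _⇒ᶠ_ : Formula d s U N k → Formula d s U N k → Formula d s U N k

module _ {d s : ℕ} {U N : Set} {k : ℕ} where

  infixr 6 _⇔ᶠ_

  ⊥ᶠ : Formula d s U N k
  ⊥ᶠ = ¬ᶠ ⊤ᶠ

  _⇔ᶠ_ : Formula d s U N k → Formula d s U N k → Formula d s U N k
  φ ⇔ᶠ ψ = (φ ⇒ᶠ ψ) ∧ᶠ (ψ ⇒ᶠ φ)

  ⋀ ⋁ : (n : ℕ) → (Fin n → Formula d s U N k) → Formula d s U N k
  ⋀ zero    φ = ⊤ᶠ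
  ⋀ (suc n) φ = φ zero ∧ᶠ ⋀ n (φ ∘ suc)
  ⋁ zero    φ = ⊥ᶠ
  ⋁ (suc n) φ = φ zero ∨ᶠ ⋁ n (φ ∘ suc)

module Semantics {d s m : ℕ} (p : Picture d s m) {U N : Set}
                 (R₁ : U → Point d m → Bool) (R₀ : N → Bool) where

  infix 4 _⊨ᶠ_
  _⊨ᶠ_ : ∀ {k} → Env d m k → Formula d s U N k → Set
  ρ ⊨ᶠ pixel c t  = p (evalT p ρ t) ≡ c
  ρ ⊨ᶠ atMin i t  = lookup (evalT p ρ t) i ≡ zero
  ρ ⊨ᶠ atMax i t  = lookup (evalT p ρ t) i ≡ fromℕ m
  ρ ⊨ᶠ t ≐ u      = evalT p ρ t ≡ evalT p ρ u
  ρ ⊨ᶠ unary r t  = T (R₁ r (evalT p ρ t))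
  ρ ⊨ᶠ nullary r  = T (R₀ r)
  ρ ⊨ᶠ ⊤ᶠ         = ⊤
  ρ ⊨ᶠ ¬ᶠ φ       = ¬ (ρ ⊨ᶠ φ)
  ρ ⊨ᶠ φ ∧ᶠ ψ     = (ρ ⊨ᶠ φ) × (ρ ⊨ᶠ ψ)
  ρ ⊨ᶠ φ ∨ᶠ ψ     = (ρ ⊨ᶠ φ) ⊎ (ρ ⊨ᶠ ψ)
  ρ ⊨ᶠ φ ⇒ᶠ ψ     = ρ ⊨ᶠ φ → ρ ⊨ᶠ ψ

  ⊨ᶠ-dec : ∀ {k} (ρ : Env d m k) (φ : Formula d s U N k) → Dec (ρ ⊨ᶠ φ)
  ⊨ᶠ-dec ρ (pixel c t) = p (evalT p ρ t) Finₚ.≟ c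
  ⊨ᶠ-dec ρ (atMin i t) = lookup (evalT p ρ t) i Finₚ.≟ zero
  ⊨ᶠ-dec ρ (atMax i t) = lookup (evalT p ρ t) i Finₚ.≟ fromℕ m
  ⊨ᶠ-dec ρ (t ≐ u) = Vecₚ.≡-dec Finₚ._≟_ (evalT p ρ t) (evalT p ρ u)
  ⊨ᶠ-dec ρ (unary r t) = T? (R₁ r (evalT p ρ t))
  ⊨ᶠ-dec ρ (nullary r) = T? (R₀ r)
  ⊨ᶠ-dec ρ ⊤ᶠ = yes tt
  ⊨ᶠ-dec ρ (¬ᶠ φ) = ¬? (⊨ᶠ-dec ρ φ)
  ⊨ᶠ-dec ρ (φ ∧ᶠ ψ) = ⊨ᶠ-dec ρ φ ×-dec ⊨ᶠ-dec ρ ψ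
  ⊨ᶠ-dec ρ (φ ∨ᶠ ψ) = ⊨ᶠ-dec ρ φ ⊎-dec ⊨ᶠ-dec ρ ψ
  ⊨ᶠ-dec ρ (φ ⇒ᶠ ψ) = ⊨ᶠ-dec ρ φ →-dec ⊨ᶠ-dec ρ ψ

  module _ {k : ℕ} {ρ : Env d m k} where

    ⊨ᶠ-⋀⁺ : ∀ n {φ : Fin n → Formula d s U N k} → (∀ i → ρ ⊨ᶠ φ i) → ρ ⊨ᶠ ⋀ n φ
    ⊨ᶠ-⋀⁺ zero    _ = tt
    ⊨ᶠ-⋀⁺ (suc n) h = h zero , ⊨ᶠ-⋀⁺ n (h ∘ suc)

    ⊨ᶠ-⋀⁻ : ∀ n {φ : Fin n → Formula d s U N k} → ρ ⊨ᶠ ⋀ n φ → ∀ i → ρ ⊨ᶠ φ i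
    ⊨ᶠ-⋀⁻ (suc n) (h , _) zero    = h
    ⊨ᶠ-⋀⁻ (suc n) (_ , h) (suc i) = ⊨ᶠ-⋀⁻ n h i

    ⊨ᶠ-⋁⁺ : ∀ n {φ : Fin n → Formula d s U N k} i → ρ ⊨ᶠ φ i → ρ ⊨ᶠ ⋁ n φ
    ⊨ᶠ-⋁⁺ (suc n) zero    h = inj₁ h
    ⊨ᶠ-⋁⁺ (suc n) (suc i) h = inj₂ (⊨ᶠ-⋁⁺ n i h)

    ⊨ᶠ-⋁⁻ : ∀ n {φ : Fin n → Formula d s U N k} → ρ ⊨ᶠ ⋁ n φ → ∃[ i ] ρ ⊨ᶠ φ i
    ⊨ᶠ-⋁⁻ zero    h = ⊥-elim (h tt)
    ⊨ᶠ-⋁⁻ (suc n) (inj₁ h) = zero , h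
    ⊨ᶠ-⋁⁻ (suc n) (inj₂ h) = let i , hi = ⊨ᶠ-⋁⁻ n h in suc i , hi

module _ {d : ℕ} where

  substTerm : ∀ {a b} → (Fin a → Term d b) → Term d a → Term d b
  substTerm σ (var x) = σ x
  substTerm σ (succ i t) = succ i (substTerm σ t)

  module _ {s : ℕ} {U N : Set} where

    substFormula : ∀ {a b} → (Fin a → Term d b) → Formula d s U N a → Formula d s U N b
    substFormula σ (pixel c t) = pixel c (substTerm σ t)
    substFormula σ (atMin i t) = atMin i (substTerm σ t)
    substFormula σ (atMax i t) = atMax i (substTerm σ t)
    substFormula σ (t ≐ u) = substTerm σ t ≐ substTerm σ u
    substFormula σ (unary r t) = unary r (substTerm σ t)
    substFormula σ (nullary r) = nullary r
    substFormula σ ⊤ᶠ = ⊤ᶠ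
    substFormula σ (¬ᶠ φ) = ¬ᶠ substFormula σ φ
    substFormula σ (φ ∧ᶠ ψ) = substFormula σ φ ∧ᶠ substFormula σ ψ
    substFormula σ (φ ∨ᶠ ψ) = substFormula σ φ ∨ᶠ substFormula σ ψ
    substFormula σ (φ ⇒ᶠ ψ) = substFormula σ φ ⇒ᶠ substFormula σ ψ

    rename : ∀ {U′ N′ k} → (U → U′) → (N → N′) → Formula d s U N k → Formula d s U′ N′ k
    rename f g (pixel c t) = pixel c t
    rename f g (atMin i t) = atMin i t
    rename f g (atMax i t) = atMax i t
    rename f g (t ≐ u) = t ≐ u
    rename f g (unary r t) = unary (f r) t
    rename f g (nullary r) = nullary (g r)
    rename f g ⊤ᶠ = ⊤ᶠ
    rename f g (¬ᶠ φ) = ¬ᶠ rename f g φ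
    rename f g (φ ∧ᶠ ψ) = rename f g φ ∧ᶠ rename f g ψ
    rename f g (φ ∨ᶠ ψ) = rename f g φ ∨ᶠ rename f g ψ
    rename f g (φ ⇒ᶠ ψ) = rename f g φ ⇒ᶠ rename f g ψ

module _ {d s m : ℕ} (p : Picture d s m) where

  evalT-substTerm : ∀ {a b} (σ : Fin a → Term d b) (ρ : Env d m b) (t : Term d a) →
                    evalT p ρ (substTerm σ t) ≡ evalT p (evalT p ρ ∘ σ) t
  evalT-substTerm σ ρ (var x) = refl
  evalT-substTerm σ ρ (succ i t) = cong (succAt i) (evalT-substTerm σ ρ t)

  evalT-cong : ∀ {k} {ρ ρ′ : Env d m k} → (∀ i → ρ i ≡ ρ′ i) → ∀ t → evalT p ρ t ≡ evalT p ρ′ t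
  evalT-cong ρ≗ρ′ (var x) = ρ≗ρ′ x
  evalT-cong ρ≗ρ′ (succ i t) = cong (succAt i) (evalT-cong ρ≗ρ′ t)

  module _ {U N : Set} (R₁ : U → Point d m → Bool) (R₀ : N → Bool) where
    open Semantics p R₁ R₀

    ⊨ᶠ-substFormula : ∀ {a b} (σ : Fin a → Term d b) (ρ : Env d m b) (φ : Formula d s U N a) →
                      (ρ ⊨ᶠ substFormula σ φ) ≡ (evalT p ρ ∘ σ ⊨ᶠ φ)
    ⊨ᶠ-substFormula σ ρ (pixel c t) = cong (λ x → p x ≡ c) (evalT-substTerm σ ρ t)
    ⊨ᶠ-substFormula σ ρ (atMin i t) = cong (λ x → lookup x i ≡ zero) (evalT-substTerm σ ρ t)
    ⊨ᶠ-substFormula σ ρ (atMax i t) = cong (λ x → lookup x i ≡ fromℕ m) (evalT-substTerm σ ρ t)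
    ⊨ᶠ-substFormula σ ρ (t ≐ u) = cong₂ _≡_ (evalT-substTerm σ ρ t) (evalT-substTerm σ ρ u)
    ⊨ᶠ-substFormula σ ρ (unary r t) = cong (T ∘ R₁ r) (evalT-substTerm σ ρ t)
    ⊨ᶠ-substFormula σ ρ (nullary r) = refl
    ⊨ᶠ-substFormula σ ρ ⊤ᶠ = refl
    ⊨ᶠ-substFormula σ ρ (¬ᶠ φ) = cong ¬_ (⊨ᶠ-substFormula σ ρ φ)
    ⊨ᶠ-substFormula σ ρ (φ ∧ᶠ ψ) = cong₂ _×_ (⊨ᶠ-substFormula σ ρ φ) (⊨ᶠ-substFormula σ ρ ψ)
    ⊨ᶠ-substFormula σ ρ (φ ∨ᶠ ψ) = cong₂ _⊎_ (⊨ᶠ-substFormula σ ρ φ) (⊨ᶠ-substFormula σ ρ ψ)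
    ⊨ᶠ-substFormula σ ρ (φ ⇒ᶠ ψ) = cong₂ (λ A B → A → B) (⊨ᶠ-substFormula σ ρ φ) (⊨ᶠ-substFormula σ ρ ψ)

    ⊨ᶠ-cong-env : ∀ {k} {ρ ρ′ : Env d m k} → (∀ i → ρ i ≡ ρ′ i) → (φ : Formula d s U N k) →
                  (ρ ⊨ᶠ φ) ≡ (ρ′ ⊨ᶠ φ)
    ⊨ᶠ-cong-env ρ≗ρ′ (pixel c t) = cong (λ x → p x ≡ c) (evalT-cong ρ≗ρ′ t)
    ⊨ᶠ-cong-env ρ≗ρ′ (atMin i t) = cong (λ x → lookup x i ≡ zero) (evalT-cong ρ≗ρ′ t)
    ⊨ᶠ-cong-env ρ≗ρ′ (atMax i t) = cong (λ x → lookup x i ≡ fromℕ m) (evalT-cong ρ≗ρ′ t)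
    ⊨ᶠ-cong-env ρ≗ρ′ (t ≐ u) = cong₂ _≡_ (evalT-cong ρ≗ρ′ t) (evalT-cong ρ≗ρ′ u)
    ⊨ᶠ-cong-env ρ≗ρ′ (unary r t) = cong (T ∘ R₁ r) (evalT-cong ρ≗ρ′ t)
    ⊨ᶠ-cong-env ρ≗ρ′ (nullary r) = refl
    ⊨ᶠ-cong-env ρ≗ρ′ ⊤ᶠ = refl
    ⊨ᶠ-cong-env ρ≗ρ′ (¬ᶠ φ) = cong ¬_ (⊨ᶠ-cong-env ρ≗ρ′ φ)
    ⊨ᶠ-cong-env ρ≗ρ′ (φ ∧ᶠ ψ) = cong₂ _×_ (⊨ᶠ-cong-env ρ≗ρ′ φ) (⊨ᶠ-cong-env ρ≗ρ′ ψ)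
    ⊨ᶠ-cong-env ρ≗ρ′ (φ ∨ᶠ ψ) = cong₂ _⊎_ (⊨ᶠ-cong-env ρ≗ρ′ φ) (⊨ᶠ-cong-env ρ≗ρ′ ψ)
    ⊨ᶠ-cong-env ρ≗ρ′ (φ ⇒ᶠ ψ) = cong₂ (λ A B → A → B) (⊨ᶠ-cong-env ρ≗ρ′ φ) (⊨ᶠ-cong-env ρ≗ρ′ ψ)

  module _ {U N U′ N′ : Set} (f : U → U′) (g : N → N′)
           (R₁ : U′ → Point d m → Bool) (R₀ : N′ → Bool) where
    open Semantics p R₁ R₀ using (_⊨ᶠ_)
    open Semantics p (R₁ ∘ f) (R₀ ∘ g) renaming (_⊨ᶠ_ to _⊨ᶠ′_) using ()

    ⊨ᶠ-rename : ∀ {k} (ρ : Env d m k) (φ : Formula d s U N k) →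
                (ρ ⊨ᶠ rename f g φ) ≡ (ρ ⊨ᶠ′ φ)
    ⊨ᶠ-rename ρ (pixel c t) = refl
    ⊨ᶠ-rename ρ (atMin i t) = refl
    ⊨ᶠ-rename ρ (atMax i t) = refl
    ⊨ᶠ-rename ρ (t ≐ u) = refl
    ⊨ᶠ-rename ρ (unary r t) = refl
    ⊨ᶠ-rename ρ (nullary r) = refl
    ⊨ᶠ-rename ρ ⊤ᶠ = refl
    ⊨ᶠ-rename ρ (¬ᶠ φ) = cong ¬_ (⊨ᶠ-rename ρ φ)
    ⊨ᶠ-rename ρ (φ ∧ᶠ ψ) = cong₂ _×_ (⊨ᶠ-rename ρ φ) (⊨ᶠ-rename ρ ψ)
    ⊨ᶠ-rename ρ (φ ∨ᶠ ψ) = cong₂ _⊎_ (⊨ᶠ-rename ρ φ) (⊨ᶠ-rename ρ ψ)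
    ⊨ᶠ-rename ρ (φ ⇒ᶠ ψ) = cong₂ (λ A B → A → B) (⊨ᶠ-rename ρ φ) (⊨ᶠ-rename ρ ψ)

Finite : Set → Set
Finite A = ∃[ n ] Fin n ↔ A

finite-Fin : ∀ n → Finite (Fin n)
finite-Fin n = n , ↔-refl

finite-⊤ : Finite ⊤
finite-⊤ = 1 , Finₚ.1↔⊤

finite-Bool : Finite Bool
finite-Bool = 2 , Finₚ.2↔Bool

finite-⊎ : ∀ {A B} → Finite A → Finite B → Finite (A ⊎ B)
finite-⊎ (m , A↔) (n , B↔) = m + n , ↔-trans Finₚ.+↔⊎ (A↔ ⊎-↔ B↔)

finite-× : ∀ {A B} → Finite A → Finite B → Finite (A × B)
finite-× (m , A↔) (n , B↔) = m ℕ.* n , ↔-trans Finₚ.*↔× (A↔ ×-↔ B↔)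

record UnarySentence (d s k : ℕ) : Set₁ where
  field
    Unary Nullary : Set
    finiteUnary   : Finite Unary
    finiteNullary : Finite Nullary
    matrix        : Formula d s Unary Nullary k

open UnarySentence

_⊨ˢ_ : ∀ {d s m k} → Picture d s m → UnarySentence d s k → Set
_⊨ˢ_ {d} {m = m} p S =
  Σ (Unary S → Point d m → Bool) λ R₁ → Σ (Nullary S → Bool) λ R₀ →
    ∀ ρ → Semantics._⊨ᶠ_ p R₁ R₀ ρ (matrix S)

-- From ESO(∀^k, arity 1) to unary sentences and back

reflects-⌊⌋ : ∀ {A : Set} (a? : Dec A) → Reflects A ⌊ a? ⌋
reflects-⌊⌋ (yes a) = ofʸ a
reflects-⌊⌋ (no ¬a) = ofⁿ ¬a

reflects-≡true : ∀ {A : Set} {b} → Reflects A b → (b ≡ true) ⇔ A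
reflects-≡true (ofʸ a) = mk⇔ (λ _ → a) (λ _ → refl)
reflects-≡true (ofⁿ ¬a) = mk⇔ (λ ()) (λ a → contradiction a ¬a)

relation≤1 : ∀ {A : Set} {n} → n ≤ 1 → (A → Bool) → Bool → Vec A n → Bool
relation≤1 z≤n       _ b []       = b
relation≤1 (s≤s z≤n) f _ (x ∷ []) = f x

relation≤1-replicate : ∀ {A : Set} {n} (n≤1 : n ≤ 1) (F : Vec A n → Bool) (a : A) (v : Vec A n) →
                      F v ≡ relation≤1 n≤1 (F ∘ replicate n) (F (replicate n a)) v
relation≤1-replicate z≤n       F a []       = refl
relation≤1-replicate (s≤s z≤n) F a (x ∷ []) = refl

module FromESO {d s r : ℕ} (ar : Vec ℕ r) (ar≤1 : All (_≤ 1) ar) where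

  relAtom : ∀ {k n} → n ≤ 1 → Fin r → Vec (Term d k) n → Formula d s (Fin r) (Fin r) k
  relAtom z≤n       j []       = nullary j
  relAtom (s≤s z≤n) j (t ∷ []) = unary j t

  fromQF : ∀ {k} → QF d s ar k → Formula d s (Fin r) (Fin r) k
  fromQF (Qs c t) = pixel c t
  fromQF (minA i t) = atMin i t
  fromQF (maxA i t) = atMax i t
  fromQF (eqA t u) = t ≐ u
  fromQF (relA j ts) = relAtom (Allₚ.lookup⁺ ar≤1 j) j ts
  fromQF (¬' θ) = ¬ᶠ fromQF θ
  fromQF (θ ∧' η) = fromQF θ ∧ᶠ fromQF η
  fromQF (θ ∨' η) = fromQF θ ∨ᶠ fromQF η

  module _ {m : ℕ} (p : Picture d s m) (R₁ : Fin r → Point d m → Bool) (R₀ : Fin r → Bool)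
           (R : RelInterp p ar)
           (R≡ : ∀ j v → R j v ≡ relation≤1 (Allₚ.lookup⁺ ar≤1 j) (R₁ j) (R₀ j) v) where
    open Semantics p R₁ R₀

    reflects-relAtom : ∀ {k n} (n≤1 : n ≤ 1) (ρ : Env d m k) j (ts : Vec (Term d k) n) →
                       Reflects (ρ ⊨ᶠ relAtom n≤1 j ts) (relation≤1 n≤1 (R₁ j) (R₀ j) (map (evalT p ρ) ts))
    reflects-relAtom z≤n       ρ j []       = T-reflects _
    reflects-relAtom (s≤s z≤n) ρ j (t ∷ []) = T-reflects _

    reflects-fromQF : ∀ {k} (ρ : Env d m k) (θ : QF d s ar k) → Reflects (ρ ⊨ᶠ fromQF θ) (evalF p R ρ θ)
    reflects-fromQF ρ (Qs c t) = reflects-⌊⌋ (p (evalT p ρ t) Finₚ.≟ c)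
    reflects-fromQF ρ (minA i t) = reflects-⌊⌋ (lookup (evalT p ρ t) i Finₚ.≟ zero)
    reflects-fromQF ρ (maxA i t) = reflects-⌊⌋ (lookup (evalT p ρ t) i Finₚ.≟ fromℕ m)
    reflects-fromQF ρ (eqA t u) = reflects-⌊⌋ (Vecₚ.≡-dec Finₚ._≟_ (evalT p ρ t) (evalT p ρ u))
    reflects-fromQF ρ (relA j ts) rewrite R≡ j (map (evalT p ρ) ts) =
      reflects-relAtom (Allₚ.lookup⁺ ar≤1 j) ρ j ts
    reflects-fromQF ρ (¬' θ) = ¬-reflects (reflects-fromQF ρ θ)
    reflects-fromQF ρ (θ ∧' η) = reflects-fromQF ρ θ ×-reflects reflects-fromQF ρ η
    reflects-fromQF ρ (θ ∨' η) = reflects-fromQF ρ θ ⊎-reflects reflects-fromQF ρ η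

fromESO : ∀ {d s k} → ESO∀ d s k 1 → UnarySentence d s k
fromESO (eso r ar ar≤1 θ) = record
  { Unary = Fin r ; Nullary = Fin r
  ; finiteUnary = finite-Fin r ; finiteNullary = finite-Fin r
  ; matrix = FromESO.fromQF ar ar≤1 θ }

fromESO-correct : ∀ {d s m k} (p : Picture d s m) (Φ : ESO∀ d s k 1) → (p ⊨∀ Φ) ⇔ (p ⊨ˢ fromESO Φ)
fromESO-correct {d} {m = m} p (eso r ar ar≤1 θ) = mk⇔ complete sound
  where
  open FromESO ar ar≤1
  origin : Point d m
  origin = replicate d zero
  complete : p ⊨∀ eso r ar ar≤1 θ → p ⊨ˢ fromESO (eso r ar ar≤1 θ)
  complete (R , holds) = R₁ , R₀ , λ ρ →
    Equivalence.to (reflects-≡true (reflects-fromQF p R₁ R₀ R R≡ ρ θ)) (holds ρ)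
    where
    R₁ : Fin r → Point d m → Bool
    R₁ j = R j ∘ replicate (lookup ar j)
    R₀ : Fin r → Bool
    R₀ j = R j (replicate (lookup ar j) origin)
    R≡ : ∀ j v → R j v ≡ relation≤1 (Allₚ.lookup⁺ ar≤1 j) (R₁ j) (R₀ j) v
    R≡ j = relation≤1-replicate (Allₚ.lookup⁺ ar≤1 j) (R j) origin
  sound : p ⊨ˢ fromESO (eso r ar ar≤1 θ) → p ⊨∀ eso r ar ar≤1 θ
  sound (R₁ , R₀ , holds) = R , λ ρ →
    Equivalence.from (reflects-≡true (reflects-fromQF p R₁ R₀ R (λ _ _ → refl) ρ θ)) (holds ρ)
    where
    R : RelInterp p ar
    R j = relation≤1 (Allₚ.lookup⁺ ar≤1 j) (R₁ j) (R₀ j)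

module ToESO {d s : ℕ} {U N : Set} (finU : Finite U) (finN : Finite N) where
  private
    a = proj₁ finU
    b = proj₁ finN
    module U = Inverse (proj₂ finU)
    module N = Inverse (proj₂ finN)

  arities : Vec ℕ (a + b)
  arities = replicate a 1 ++ replicate b 0

  arities≤1 : All (_≤ 1) arities
  arities≤1 = Allₚ.++⁺ (all-replicate a (s≤s z≤n)) (all-replicate b z≤n)
    where
    all-replicate : ∀ {x} n → x ≤ 1 → All (_≤ 1) (replicate n x)
    all-replicate zero    _   = []
    all-replicate (suc n) x≤1 = x≤1 ∷ all-replicate n x≤1

  unarySym : U → Fin (a + b)
  unarySym u = U.from u ↑ˡ b

  nullarySym : N → Fin (a + b)
  nullarySym n = a ↑ʳ N.from n

  arity-unarySym : ∀ u → lookup arities (unarySym u) ≡ 1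
  arity-unarySym u =
    trans (Vecₚ.lookup-++ˡ (replicate a 1) _ (U.from u)) (Vecₚ.lookup-replicate (U.from u) 1)

  arity-nullarySym : ∀ n → lookup arities (nullarySym n) ≡ 0
  arity-nullarySym n =
    trans (Vecₚ.lookup-++ʳ (replicate a 1) _ (N.from n)) (Vecₚ.lookup-replicate (N.from n) 0)

  toQF : ∀ {k} → Formula d s U N (suc k) → QF d s arities (suc k)
  toQF (pixel c t) = Qs c t
  toQF (atMin i t) = minA i t
  toQF (atMax i t) = maxA i t
  toQF (t ≐ u) = eqA t u
  toQF (unary r t) = relA (unarySym r) (cast (sym (arity-unarySym r)) (t ∷ []))
  toQF (nullary r) = relA (nullarySym r) (cast (sym (arity-nullarySym r)) [])
  toQF ⊤ᶠ = eqA (var zero) (var zero)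
  toQF (¬ᶠ φ) = ¬' (toQF φ)
  toQF (φ ∧ᶠ ψ) = toQF φ ∧' toQF ψ
  toQF (φ ∨ᶠ ψ) = toQF φ ∨' toQF ψ
  toQF (φ ⇒ᶠ ψ) = ¬' (toQF φ) ∨' toQF ψ

  module _ {m : ℕ} (p : Picture d s m) (R₁ : U → Point d m → Bool) (R₀ : N → Bool)
           (R : RelInterp p arities)
           (R₁≡ : ∀ r x → R₁ r x ≡ R (unarySym r) (cast (sym (arity-unarySym r)) (x ∷ [])))
           (R₀≡ : ∀ r → R₀ r ≡ R (nullarySym r) (cast (sym (arity-nullarySym r)) [])) where
    open Semantics p R₁ R₀

    reflects-toQF : ∀ {k} (ρ : Env d m (suc k)) (φ : Formula d s U N (suc k)) →
                    Reflects (ρ ⊨ᶠ φ) (evalF p R ρ (toQF φ))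
    reflects-toQF ρ (pixel c t) = reflects-⌊⌋ (p (evalT p ρ t) Finₚ.≟ c)
    reflects-toQF ρ (atMin i t) = reflects-⌊⌋ (lookup (evalT p ρ t) i Finₚ.≟ zero)
    reflects-toQF ρ (atMax i t) = reflects-⌊⌋ (lookup (evalT p ρ t) i Finₚ.≟ fromℕ m)
    reflects-toQF ρ (t ≐ u) = reflects-⌊⌋ (Vecₚ.≡-dec Finₚ._≟_ (evalT p ρ t) (evalT p ρ u))
    reflects-toQF ρ (unary r t)
      rewrite Vecₚ.map-cast (evalT p ρ) (sym (arity-unarySym r)) (t ∷ [])
            | sym (R₁≡ r (evalT p ρ t)) = T-reflects _
    reflects-toQF ρ (nullary r)
      rewrite Vecₚ.map-cast (evalT p ρ) (sym (arity-nullarySym r)) []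
            | sym (R₀≡ r) = T-reflects _
    reflects-toQF ρ ⊤ᶠ with Vecₚ.≡-dec Finₚ._≟_ (ρ zero) (ρ zero)
    ... | yes _ = ofʸ tt
    ... | no x≢x = contradiction refl x≢x
    reflects-toQF ρ (¬ᶠ φ) = ¬-reflects (reflects-toQF ρ φ)
    reflects-toQF ρ (φ ∧ᶠ ψ) = reflects-toQF ρ φ ×-reflects reflects-toQF ρ ψ
    reflects-toQF ρ (φ ∨ᶠ ψ) = reflects-toQF ρ φ ⊎-reflects reflects-toQF ρ ψ
    reflects-toQF ρ (φ ⇒ᶠ ψ) = reflects-toQF ρ φ →-reflects reflects-toQF ρ ψ

toESO : ∀ {d s} → UnarySentence d s 1 → ESO∀ d s 1 1
toESO S = eso _ arities arities≤1 (toQF (matrix S))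
  where open ToESO (finiteUnary S) (finiteNullary S)

toESO-correct : ∀ {d s m} (p : Picture d s m) (S : UnarySentence d s 1) → (p ⊨ˢ S) ⇔ (p ⊨∀ toESO S)
toESO-correct {d} {m = m} p S = mk⇔ complete sound
  where
  open ToESO (finiteUnary S) (finiteNullary S)
  module U = Inverse (proj₂ (finiteUnary S))
  module N = Inverse (proj₂ (finiteNullary S))

  headOr : ∀ {n} → Point d m → Vec (Point d m) n → Point d m
  headOr x []      = x
  headOr _ (x ∷ _) = x

  headOr-cast : ∀ {n} (eq : 1 ≡ n) o x → headOr o (cast eq (x ∷ [])) ≡ x
  headOr-cast refl o x = refl

  complete : p ⊨ˢ S → p ⊨∀ toESO S
  complete (R₁ , R₀ , holds) = R , λ ρ →
    Equivalence.from (reflects-≡true (reflects-toQF p R₁ R₀ R R₁≡ R₀≡ ρ (matrix S))) (holds ρ)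
    where
    R : RelInterp p arities
    R j v = [ (λ i → R₁ (U.to i) (headOr (replicate d zero) v)) , (λ i → R₀ (N.to i)) ]′
              (splitAt (proj₁ (finiteUnary S)) j)
    R₁≡ : ∀ r x → R₁ r x ≡ R (unarySym r) (cast (sym (arity-unarySym r)) (x ∷ []))
    R₁≡ r x rewrite Finₚ.splitAt-↑ˡ _ (U.from r) (proj₁ (finiteNullary S))
                  | U.strictlyInverseˡ r = cong (R₁ r) (sym (headOr-cast (sym (arity-unarySym r)) _ x))
    R₀≡ : ∀ r → R₀ r ≡ R (nullarySym r) (cast (sym (arity-nullarySym r)) [])
    R₀≡ r rewrite Finₚ.splitAt-↑ʳ (proj₁ (finiteUnary S)) (proj₁ (finiteNullary S)) (N.from r)
                | N.strictlyInverseˡ r = refl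

  sound : p ⊨∀ toESO S → p ⊨ˢ S
  sound (R , holds) = R₁ , R₀ , λ ρ →
    Equivalence.to (reflects-≡true (reflects-toQF p R₁ R₀ R (λ _ _ → refl) (λ _ → refl) ρ (matrix S)))
      (holds ρ)
    where
    R₁ : Unary S → Point d m → Bool
    R₁ r x = R (unarySym r) (cast (sym (arity-unarySym r)) (x ∷ []))
    R₀ : Nullary S → Bool
    R₀ r = R (nullarySym r) (cast (sym (arity-nullarySym r)) [])

-- Unary relations certifying that M holds at at most one point: H i is a
-- union of hyperplanes orthogonal to axis i containing M, and the sweep A i,
-- which propagates along axis i from H i but never runs into H i again,
-- shows that each axis-i line meets H i at most once.

module _ {d m : ℕ} where

  record SingletonCertificate (M : Point d m → Bool) (H A : Fin d → Point d m → Bool) : Set where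
    field
      mark⇒hyperplane : ∀ i x → T (M x) → T (H i x)
      hyperplane-transversal : ∀ i j x → j ≢ i → T (H i x) → T (H i (succAt j x))
      hyperplane⇒sweep : ∀ i x → T (H i x) → T (A i x)
      sweep-keeps : ∀ i x → lookup x i ≢ fromℕ m → T (A i x) → T (A i (succAt i x))
      sweep-once : ∀ i x → lookup x i ≢ fromℕ m → ¬ (T (A i x) × T (H i (succAt i x)))

  line : Fin d → Point d m → ℕ → Point d m
  line i x = fold (x [ i ]≔ zero) (succAt i)

  toℕ-line : ∀ i x {n} → n ≤ m → toℕ (lookup (line i x n) i) ≡ n
  toℕ-line i x {n} n≤m = begin
    toℕ (lookup (line i x n) i)
      ≡⟨ cong (λ z → toℕ (lookup z i)) (fold-succAt i _ n) ⟩
    toℕ (lookup (updateAt (x [ i ]≔ zero) i (λ a → fold a csuc n)) i)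
      ≡⟨ cong toℕ (Vecₚ.lookup∘updateAt i (x [ i ]≔ zero)) ⟩
    toℕ (fold (lookup (x [ i ]≔ zero) i) csuc n)
      ≡⟨ cong (λ a → toℕ (fold a csuc n)) (Vecₚ.lookup∘updateAt i x) ⟩
    toℕ (fold zero csuc n)
      ≡⟨ toℕ-fold-csuc zero n n≤m ⟩
    n ∎
    where open ≡-Reasoning

  line-not-last : ∀ i x {n} → n < m → lookup (line i x n) i ≢ fromℕ m
  line-not-last i x {n} n<m eq = ℕₚ.<⇒≢ n<m (begin
    n                           ≡⟨ toℕ-line i x (ℕₚ.<⇒≤ n<m) ⟨
    toℕ (lookup (line i x n) i) ≡⟨ cong toℕ eq ⟩
    toℕ (fromℕ m)               ≡⟨ Finₚ.toℕ-fromℕ m ⟩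
    m                           ∎)
    where open ≡-Reasoning

  module _ {M : Point d m → Bool} {H A : Fin d → Point d m → Bool}
           (cert : SingletonCertificate M H A) where
    open SingletonCertificate cert

    hyperplane-set : ∀ {i j} x v → j ≢ i → T (H i x) → T (H i (x [ j ]≔ v))
    hyperplane-set {i} {j} x v j≢i Hx =
      let t , orbit = csuc-orbit (lookup x j) v in
      subst (T ∘ H i) (trans (fold-succAt j x t) (Vecₚ.updateAt-cong-local j x orbit)) (along t)
      where
      along : ∀ t → T (H i (fold x (succAt j) t))
      along zero = Hx
      along (suc t) = hyperplane-transversal i j _ j≢i (along t)

    -- Copy the coordinates of y into x one at a time.
    hyperplane-agree : ∀ {i} x y → lookup x i ≡ lookup y i → T (H i x) → T (H i y)
    hyperplane-agree {i} x y xᵢ≡yᵢ Hx =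
      subst (T ∘ H i) (lookup-≗⇒≡ (copied-∈ (allFin d) ∘ ∈-allFin)) (H-copy (allFin d))
      where
      copy : List (Fin d) → Point d m
      copy = List.foldr (λ j z → z [ j ]≔ lookup y j) x

      copied-∈ : ∀ js {l} → l ∈ js → lookup (copy js) l ≡ lookup y l
      copied-∈ (j ∷ js) (here refl) = Vecₚ.lookup∘updateAt j (copy js)
      copied-∈ (j ∷ js) {l} (there l∈js) with l Finₚ.≟ j
      ... | yes refl = Vecₚ.lookup∘updateAt j (copy js)
      ... | no l≢j = trans (Vecₚ.lookup∘updateAt′ l j l≢j (copy js)) (copied-∈ js l∈js)

      copied-i : ∀ js → lookup (copy js) i ≡ lookup y i
      copied-i [] = xᵢ≡yᵢ
      copied-i (j ∷ js) with i Finₚ.≟ j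
      ... | yes refl = Vecₚ.lookup∘updateAt i (copy js)
      ... | no i≢j = trans (Vecₚ.lookup∘updateAt′ i j i≢j (copy js)) (copied-i js)

      H-copy : ∀ js → T (H i (copy js))
      H-copy [] = Hx
      H-copy (j ∷ js) with j Finₚ.≟ i
      ... | yes refl =
        subst (T ∘ H i) (sym (Vecₚ.updateAt-id-local i (copy js) (sym (copied-i js)))) (H-copy js)
      ... | no j≢i = hyperplane-set (copy js) (lookup y j) j≢i (H-copy js)

    sweep-line : ∀ i x {v n} → v ≤ n → n ≤ m → T (H i (line i x v)) → T (A i (line i x n))
    sweep-line i x {n = zero} z≤n _ Hv = hyperplane⇒sweep i _ Hv
    sweep-line i x {v} {suc n} v≤1+n 1+n≤m Hv with ℕₚ.m≤n⇒m<n∨m≡n v≤1+n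
    ... | inj₁ (s≤s v≤n) = sweep-keeps i _ (line-not-last i x 1+n≤m)
                             (sweep-line i x v≤n (ℕₚ.<⇒≤ 1+n≤m) Hv)
    ... | inj₂ refl      = hyperplane⇒sweep i _ Hv

    hyperplane-once : ∀ i x {v w} → v < w → w ≤ m → T (H i (line i x v)) → ¬ T (H i (line i x w))
    hyperplane-once i x {w = suc n} (s≤s v≤n) 1+n≤m Hv Hw =
      sweep-once i _ (line-not-last i x 1+n≤m) (sweep-line i x v≤n (ℕₚ.<⇒≤ 1+n≤m) Hv , Hw)

    certificate-unique : ∀ {a b} → T (M a) → T (M b) → a ≡ b
    certificate-unique {a} {b} Ma Mb = lookup-≗⇒≡ same-coordinate
      where
      H-on-line : ∀ i {c} → T (M c) → T (H i (line i a (toℕ (lookup c i))))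
      H-on-line i {c} Mc = hyperplane-agree c _
        (Finₚ.toℕ-injective (sym (toℕ-line i a (Finₚ.toℕ≤pred[n] (lookup c i)))))
        (mark⇒hyperplane i c Mc)


      same-coordinate : ∀ i → lookup a i ≡ lookup b i
      same-coordinate i with ℕₚ.<-cmp (toℕ (lookup a i)) (toℕ (lookup b i))
      ... | tri≈ _ eq _ = Finₚ.toℕ-injective eq
      ... | tri< a<b _ _ = ⊥-elim (hyperplane-once i a a<b (Finₚ.toℕ≤pred[n] _) (H-on-line i Ma) (H-on-line i Mb))
      ... | tri> _ _ b<a = ⊥-elim (hyperplane-once i a b<a (Finₚ.toℕ≤pred[n] _) (H-on-line i Mb) (H-on-line i Ma))

  -- The certificate for the relation holding exactly at c (or nowhere):
  -- hyperplanes through c, and sweeps marking the points beyond c.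
  marks : Maybe (Point d m) → Point d m → Bool
  marks o x = ⌊ Maybeₚ.≡-dec _≟ᵖ_ o (just x) ⌋

  hyperplaneThrough : Maybe (Point d m) → Fin d → Point d m → Bool
  hyperplaneThrough nothing  i x = false
  hyperplaneThrough (just c) i x = ⌊ lookup x i Finₚ.≟ lookup c i ⌋

  sweepPast : Maybe (Point d m) → Fin d → Point d m → Bool
  sweepPast nothing  i x = false
  sweepPast (just c) i x = ⌊ toℕ (lookup c i) ≤? toℕ (lookup x i) ⌋

  certificate-of : ∀ o → SingletonCertificate (marks o) (hyperplaneThrough o) (sweepPast o)
  certificate-of nothing = record
    { mark⇒hyperplane = λ _ _ ()
    ; hyperplane-transversal = λ _ _ _ _ ()
    ; hyperplane⇒sweep = λ _ _ ()
    ; sweep-keeps = λ _ _ _ ()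
    ; sweep-once = λ _ _ _ () }
  certificate-of (just c) = record
    { mark⇒hyperplane = λ i x c≡x →
        fromWitness (cong (λ z → lookup z i) (sym (Maybeₚ.just-injective (toWitness c≡x))))
    ; hyperplane-transversal = λ i j x j≢i xᵢ≡cᵢ →
        fromWitness (trans (Vecₚ.lookup∘updateAt′ i j (j≢i ∘ sym) x) (toWitness xᵢ≡cᵢ))
    ; hyperplane⇒sweep = λ i x xᵢ≡cᵢ → fromWitness (ℕₚ.≤-reflexive (cong toℕ (sym (toWitness xᵢ≡cᵢ))))
    ; sweep-keeps = λ i x xᵢ≢last cᵢ≤xᵢ →
        fromWitness (subst (toℕ (lookup c i) ≤_) (sym (succAt-toℕ i x xᵢ≢last))
                           (ℕₚ.m≤n⇒m≤1+n (toWitness cᵢ≤xᵢ)))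
    ; sweep-once = λ i x xᵢ≢last (cᵢ≤xᵢ , x′ᵢ≡cᵢ) →
        ℕₚ.<-irrefl refl (subst (_≤ toℕ (lookup x i))
          (trans (cong toℕ (sym (toWitness x′ᵢ≡cᵢ))) (succAt-toℕ i x xᵢ≢last)) (toWitness cᵢ≤xᵢ)) }
    where
    succAt-toℕ : ∀ i x → lookup x i ≢ fromℕ m → toℕ (lookup (succAt i x) i) ≡ suc (toℕ (lookup x i))
    succAt-toℕ i x xᵢ≢last =
      trans (cong toℕ (Vecₚ.lookup∘updateAt i x)) (csuc-toℕ _ (≢fromℕ⇒toℕ< _ xᵢ≢last))

GadgetSymbol : ℕ → Set
GadgetSymbol d = ⊤ ⊎ (Fin d ⊎ Fin d)

pattern mark         = inj₁ tt
pattern hyperplane i = inj₂ (inj₁ i)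
pattern sweep i      = inj₂ (inj₂ i)

finite-GadgetSymbol : ∀ d → Finite (GadgetSymbol d)
finite-GadgetSymbol d = finite-⊎ finite-⊤ (finite-⊎ (finite-Fin d) (finite-Fin d))

certificateRelations : ∀ {d m} → Maybe (Point d m) → GadgetSymbol d → Point d m → Bool
certificateRelations o mark           = marks o
certificateRelations o (hyperplane i) = hyperplaneThrough o i
certificateRelations o (sweep i)      = sweepPast o i

module _ {d s k : ℕ} where
  private
    x : Term d (suc k)
    x = var zero

  transversal : Fin d → Fin d → Formula d s (GadgetSymbol d) ⊥ (suc k)
  transversal i j with j Finₚ.≟ i
  ... | yes _ = ⊤ᶠ
  ... | no _  = unary (hyperplane i) x ⇒ᶠ unary (hyperplane i) (succ j x)

  certifiesAxis : Fin d → Formula d s (GadgetSymbol d) ⊥ (suc k)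
  certifiesAxis i =
       (unary mark x ⇒ᶠ unary (hyperplane i) x)
    ∧ᶠ ⋀ d (transversal i)
    ∧ᶠ (unary (hyperplane i) x ⇒ᶠ unary (sweep i) x)
    ∧ᶠ (¬ᶠ atMax i x ⇒ᶠ unary (sweep i) x ⇒ᶠ unary (sweep i) (succ i x))
    ∧ᶠ (¬ᶠ atMax i x ⇒ᶠ ¬ᶠ (unary (sweep i) x ∧ᶠ unary (hyperplane i) (succ i x)))

  singletonGadget : Formula d s (GadgetSymbol d) ⊥ (suc k)
  singletonGadget = ⋀ d certifiesAxis

  module _ {m : ℕ} (p : Picture d s m) (R : GadgetSymbol d → Point d m → Bool) {R₀ : ⊥ → Bool} where
    open Semantics p R R₀

    gadget⇒certificate : (∀ ρ → ρ ⊨ᶠ singletonGadget) →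
                         SingletonCertificate (R mark) (R ∘ hyperplane) (R ∘ sweep)
    gadget⇒certificate h = record
      { mark⇒hyperplane        = λ i x → let M⇒H , _ = axis i x in M⇒H
      ; hyperplane-transversal = λ i j x → let _ , H⇒H , _ = axis i x in transversal⁻ i j (⊨ᶠ-⋀⁻ d H⇒H j)
      ; hyperplane⇒sweep       = λ i x → let _ , _ , H⇒A , _ = axis i x in H⇒A
      ; sweep-keeps            = λ i x → let _ , _ , _ , A⇒A , _ = axis i x in A⇒A
      ; sweep-once             = λ i x → let _ , _ , _ , _ , once = axis i x in once }
      where
      axis : ∀ i x → const x ⊨ᶠ certifiesAxis i
      axis i x = ⊨ᶠ-⋀⁻ d (h (const x)) i
      transversal⁻ : ∀ i j {ρ : Env d m (suc k)} → ρ ⊨ᶠ transversal i j → j ≢ i →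
                     T (R (hyperplane i) (ρ zero)) → T (R (hyperplane i) (succAt j (ρ zero)))
      transversal⁻ i j holds j≢i with j Finₚ.≟ i
      ... | yes j≡i = contradiction j≡i j≢i
      ... | no _    = holds

    certificate⇒gadget : SingletonCertificate (R mark) (R ∘ hyperplane) (R ∘ sweep) →
                         ∀ ρ → ρ ⊨ᶠ singletonGadget
    certificate⇒gadget cert ρ = ⊨ᶠ-⋀⁺ d λ i →
        mark⇒hyperplane i (ρ zero)
      , ⊨ᶠ-⋀⁺ d (transversal⁺ i)
      , hyperplane⇒sweep i (ρ zero)
      , sweep-keeps i (ρ zero)
      , sweep-once i (ρ zero)
      where
      open SingletonCertificate cert
      transversal⁺ : ∀ i j → ρ ⊨ᶠ transversal i j
      transversal⁺ i j with j Finₚ.≟ i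
      ... | yes _   = tt
      ... | no j≢i = hyperplane-transversal i j (ρ zero) j≢i

-- Separating the first variable y from the remaining variables xs

module Separation {d s : ℕ} {U N : Set} {k : ℕ} where

  K : ℕ
  K = suc k

  splitTerm : Term d (suc K) → Term d 1 ⊎ Term d K
  splitTerm (var zero)    = inj₁ (var zero)
  splitTerm (var (suc i)) = inj₂ (var i)
  splitTerm (succ i t)    = Sum.map (succ i) (succ i) (splitTerm t)

  infix  9 ¬ˢ_
  infixr 8 _∧ˢ_
  infixr 7 _∨ˢ_
  infixr 6 _⇒ˢ_

  data Separated : Set where
    onY            : Formula d s U N 1 → Separated
    onXs           : Formula d s U N K → Separated
    crossing       : Term d 1 → Term d K → Separated
    ¬ˢ_            : Separated → Separated
    _∧ˢ_ _∨ˢ_ _⇒ˢ_ : Separated → Separated → Separated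

  atomOn : (∀ {l} → Term d l → Formula d s U N l) → Term d 1 ⊎ Term d K → Separated
  atomOn atom (inj₁ a) = onY (atom a)
  atomOn atom (inj₂ b) = onXs (atom b)

  equation : Term d 1 ⊎ Term d K → Term d 1 ⊎ Term d K → Separated
  equation (inj₁ a) (inj₁ a′) = onY (a ≐ a′)
  equation (inj₂ b) (inj₂ b′) = onXs (b ≐ b′)
  equation (inj₁ a) (inj₂ b)  = crossing a b
  equation (inj₂ b) (inj₁ a)  = crossing a b

  separate : Formula d s U N (suc K) → Separated
  separate (pixel c t) = atomOn (pixel c) (splitTerm t)
  separate (atMin i t) = atomOn (atMin i) (splitTerm t)
  separate (atMax i t) = atomOn (atMax i) (splitTerm t)
  separate (t ≐ u)     = equation (splitTerm t) (splitTerm u)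
  separate (unary r t) = atomOn (unary r) (splitTerm t)
  separate (nullary r) = onXs (nullary r)
  separate ⊤ᶠ          = onXs ⊤ᶠ
  separate (¬ᶠ φ)      = ¬ˢ separate φ
  separate (φ ∧ᶠ ψ)    = separate φ ∧ˢ separate ψ
  separate (φ ∨ᶠ ψ)    = separate φ ∨ˢ separate ψ
  separate (φ ⇒ᶠ ψ)    = separate φ ⇒ˢ separate ψ

  crossCount : Separated → ℕ
  crossCount (onY _)        = 0
  crossCount (onXs _)       = 0
  crossCount (crossing _ _) = 1
  crossCount (¬ˢ φ)         = crossCount φ
  crossCount (φ ∧ˢ ψ)       = crossCount φ + crossCount ψ
  crossCount (φ ∨ˢ ψ)       = crossCount φ + crossCount ψ
  crossCount (φ ⇒ˢ ψ)       = crossCount φ + crossCount ψ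

  crossings : (φ : Separated) → Vec (Term d 1 × Term d K) (crossCount φ)
  crossings (onY _)        = []
  crossings (onXs _)       = []
  crossings (crossing a b) = (a , b) ∷ []
  crossings (¬ˢ φ)         = crossings φ
  crossings (φ ∧ˢ ψ)       = crossings φ ++ crossings ψ
  crossings (φ ∨ˢ ψ)       = crossings φ ++ crossings ψ
  crossings (φ ⇒ˢ ψ)       = crossings φ ++ crossings ψ

  -- the y-type: the truth values of the atoms about y
  YType : Separated → Set
  YType (onY _)        = Bool
  YType (onXs _)       = ⊤
  YType (crossing _ _) = ⊤
  YType (¬ˢ φ)         = YType φ
  YType (φ ∧ˢ ψ)       = YType φ × YType ψ
  YType (φ ∨ˢ ψ)       = YType φ × YType ψ
  YType (φ ⇒ˢ ψ)       = YType φ × YType ψ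

  finiteYType : ∀ φ → Finite (YType φ)
  finiteYType (onY _)        = finite-Bool
  finiteYType (onXs _)       = finite-⊤
  finiteYType (crossing _ _) = finite-⊤
  finiteYType (¬ˢ φ)         = finiteYType φ
  finiteYType (φ ∧ˢ ψ)       = finite-× (finiteYType φ) (finiteYType ψ)
  finiteYType (φ ∨ˢ ψ)       = finite-× (finiteYType φ) (finiteYType ψ)
  finiteYType (φ ⇒ˢ ψ)       = finite-× (finiteYType φ) (finiteYType ψ)

  -- the point x₀ has y-type σ
  hasType : (φ : Separated) → YType φ → Formula d s U N K
  hasType (onY a) b        = if b then atX₀ else ¬ᶠ atX₀
    where atX₀ = substFormula (const (var zero)) a
  hasType (onXs _) _       = ⊤ᶠ
  hasType (crossing _ _) _ = ⊤ᶠ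
  hasType (¬ˢ φ) σ         = hasType φ σ
  hasType (φ ∧ˢ ψ) (σ , τ) = hasType φ σ ∧ᶠ hasType ψ τ
  hasType (φ ∨ˢ ψ) (σ , τ) = hasType φ σ ∧ᶠ hasType ψ τ
  hasType (φ ⇒ˢ ψ) (σ , τ) = hasType φ σ ∧ᶠ hasType ψ τ

  -- what φ says about xs for a y of type σ that satisfies no crossing equation
  residual : (φ : Separated) → YType φ → Formula d s U N K
  residual (onY _) b        = if b then ⊤ᶠ else ⊥ᶠ
  residual (onXs b) _       = b
  residual (crossing _ _) _ = ⊥ᶠ
  residual (¬ˢ φ) σ         = ¬ᶠ residual φ σ
  residual (φ ∧ˢ ψ) (σ , τ) = residual φ σ ∧ᶠ residual ψ τ
  residual (φ ∨ˢ ψ) (σ , τ) = residual φ σ ∨ᶠ residual ψ τ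
  residual (φ ⇒ˢ ψ) (σ , τ) = residual φ σ ⇒ᶠ residual ψ τ

  Avoids : ∀ {m} → Picture d s m → Point d m → Env d m K → Term d 1 × Term d K → Set
  Avoids p y xs (a , b) = evalT p (const y) a ≢ evalT p xs b

  module _ {m : ℕ} (p : Picture d s m) (R₁ : U → Point d m → Bool) (R₀ : N → Bool) where
    open Semantics p R₁ R₀

    infix 4 _,_⊩_
    _,_⊩_ : Point d m → Env d m K → Separated → Set
    y , xs ⊩ onY a        = const y ⊨ᶠ a
    y , xs ⊩ onXs b       = xs ⊨ᶠ b
    y , xs ⊩ crossing a b = evalT p (const y) a ≡ evalT p xs b
    y , xs ⊩ ¬ˢ φ         = ¬ (y , xs ⊩ φ)
    y , xs ⊩ φ ∧ˢ ψ       = (y , xs ⊩ φ) × (y , xs ⊩ ψ)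
    y , xs ⊩ φ ∨ˢ ψ       = (y , xs ⊩ φ) ⊎ (y , xs ⊩ ψ)
    y , xs ⊩ φ ⇒ˢ ψ       = y , xs ⊩ φ → y , xs ⊩ ψ

    evalT-splitTerm : (ρ : Env d m (suc K)) (t : Term d (suc K)) →
                      evalT p ρ t ≡ [ evalT p (const (ρ zero)) , evalT p (ρ ∘ suc) ]′ (splitTerm t)
    evalT-splitTerm ρ (var zero)    = refl
    evalT-splitTerm ρ (var (suc i)) = refl
    evalT-splitTerm ρ (succ i t) with splitTerm t | evalT-splitTerm ρ t
    ... | inj₁ _ | eq = cong (succAt i) eq
    ... | inj₂ _ | eq = cong (succAt i) eq

    separate-correct : (ρ : Env d m (suc K)) (θ : Formula d s U N (suc K)) →
                       (ρ ⊨ᶠ θ) ⇔ (ρ zero , ρ ∘ suc ⊩ separate θ)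
    separate-correct ρ (pixel c t) with splitTerm t | evalT-splitTerm ρ t
    ... | inj₁ _ | eq rewrite eq = ⇔-id _
    ... | inj₂ _ | eq rewrite eq = ⇔-id _
    separate-correct ρ (atMin i t) with splitTerm t | evalT-splitTerm ρ t
    ... | inj₁ _ | eq rewrite eq = ⇔-id _
    ... | inj₂ _ | eq rewrite eq = ⇔-id _
    separate-correct ρ (atMax i t) with splitTerm t | evalT-splitTerm ρ t
    ... | inj₁ _ | eq rewrite eq = ⇔-id _
    ... | inj₂ _ | eq rewrite eq = ⇔-id _
    separate-correct ρ (unary r t) with splitTerm t | evalT-splitTerm ρ t
    ... | inj₁ _ | eq rewrite eq = ⇔-id _
    ... | inj₂ _ | eq rewrite eq = ⇔-id _
    separate-correct ρ (t ≐ u) with splitTerm t | evalT-splitTerm ρ t | splitTerm u | evalT-splitTerm ρ u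
    ... | inj₁ _ | eq | inj₁ _ | eq′ rewrite eq | eq′ = ⇔-id _
    ... | inj₂ _ | eq | inj₂ _ | eq′ rewrite eq | eq′ = ⇔-id _
    ... | inj₁ _ | eq | inj₂ _ | eq′ rewrite eq | eq′ = ⇔-id _
    ... | inj₂ _ | eq | inj₁ _ | eq′ rewrite eq | eq′ = mk⇔ sym sym
    separate-correct ρ (nullary r) = ⇔-id _
    separate-correct ρ ⊤ᶠ = ⇔-id _
    separate-correct ρ (¬ᶠ φ) = ¬-cong-⇔ (separate-correct ρ φ)
    separate-correct ρ (φ ∧ᶠ ψ) = separate-correct ρ φ ×-⇔ separate-correct ρ ψ
    separate-correct ρ (φ ∨ᶠ ψ) = separate-correct ρ φ ⊎-⇔ separate-correct ρ ψ
    separate-correct ρ (φ ⇒ᶠ ψ) = →-cong-⇔ (separate-correct ρ φ) (separate-correct ρ ψ)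

    typeOf : (φ : Separated) → Point d m → YType φ
    typeOf (onY a) y        = ⌊ ⊨ᶠ-dec (const y) a ⌋
    typeOf (onXs _) y       = tt
    typeOf (crossing _ _) y = tt
    typeOf (¬ˢ φ) y         = typeOf φ y
    typeOf (φ ∧ˢ ψ) y       = typeOf φ y , typeOf ψ y
    typeOf (φ ∨ˢ ψ) y       = typeOf φ y , typeOf ψ y
    typeOf (φ ⇒ˢ ψ) y       = typeOf φ y , typeOf ψ y

    private
      ⊨ᶠ-atX₀ : (ρ : Env d m K) (a : Formula d s U N 1) →
                (ρ ⊨ᶠ substFormula (const (var zero)) a) ≡ (const (ρ zero) ⊨ᶠ a)
      ⊨ᶠ-atX₀ ρ = ⊨ᶠ-substFormula p R₁ R₀ (const (var zero)) ρ

    hasType-typeOf : (φ : Separated) (ρ : Env d m K) → ρ ⊨ᶠ hasType φ (typeOf φ (ρ zero))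
    hasType-typeOf (onY a) ρ with ⊨ᶠ-dec (const (ρ zero)) a
    ... | yes y⊨a = subst id (sym (⊨ᶠ-atX₀ ρ a)) y⊨a
    ... | no y⊭a  = subst id (sym (cong ¬_ (⊨ᶠ-atX₀ ρ a))) y⊭a
    hasType-typeOf (onXs _) ρ       = tt
    hasType-typeOf (crossing _ _) ρ = tt
    hasType-typeOf (¬ˢ φ) ρ         = hasType-typeOf φ ρ
    hasType-typeOf (φ ∧ˢ ψ) ρ       = hasType-typeOf φ ρ , hasType-typeOf ψ ρ
    hasType-typeOf (φ ∨ˢ ψ) ρ       = hasType-typeOf φ ρ , hasType-typeOf ψ ρ
    hasType-typeOf (φ ⇒ˢ ψ) ρ       = hasType-typeOf φ ρ , hasType-typeOf ψ ρ

    hasType⇒typeOf : (φ : Separated) (σ : YType φ) (ρ : Env d m K) →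
                     ρ ⊨ᶠ hasType φ σ → typeOf φ (ρ zero) ≡ σ
    hasType⇒typeOf (onY a) true ρ h with ⊨ᶠ-dec (const (ρ zero)) a
    ... | yes _  = refl
    ... | no y⊭a = contradiction (subst id (⊨ᶠ-atX₀ ρ a) h) y⊭a
    hasType⇒typeOf (onY a) false ρ h with ⊨ᶠ-dec (const (ρ zero)) a
    ... | yes y⊨a = contradiction (subst id (sym (⊨ᶠ-atX₀ ρ a)) y⊨a) h
    ... | no _    = refl
    hasType⇒typeOf (onXs _) tt ρ _       = refl
    hasType⇒typeOf (crossing _ _) tt ρ _ = refl
    hasType⇒typeOf (¬ˢ φ) σ ρ h          = hasType⇒typeOf φ σ ρ h
    hasType⇒typeOf (φ ∧ˢ ψ) (σ , τ) ρ (h , h′) =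
      cong₂ _,_ (hasType⇒typeOf φ σ ρ h) (hasType⇒typeOf ψ τ ρ h′)
    hasType⇒typeOf (φ ∨ˢ ψ) (σ , τ) ρ (h , h′) =
      cong₂ _,_ (hasType⇒typeOf φ σ ρ h) (hasType⇒typeOf ψ τ ρ h′)
    hasType⇒typeOf (φ ⇒ˢ ψ) (σ , τ) ρ (h , h′) =
      cong₂ _,_ (hasType⇒typeOf φ σ ρ h) (hasType⇒typeOf ψ τ ρ h′)

    residual-correct : (φ : Separated) (y : Point d m) (xs : Env d m K) →
                       All (Avoids p y xs) (crossings φ) →
                       (y , xs ⊩ φ) ⇔ (xs ⊨ᶠ residual φ (typeOf φ y))
    residual-correct (onY a) y xs _ with ⊨ᶠ-dec (const y) a
    ... | yes y⊨a = mk⇔ (const tt) (const y⊨a)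
    ... | no y⊭a  = mk⇔ (λ y⊨a _ → y⊭a y⊨a) (λ ⊥ᶠ-holds → ⊥-elim (⊥ᶠ-holds tt))
    residual-correct (onXs _) y xs _ = ⇔-id _
    residual-correct (crossing _ _) y xs (avoids ∷ []) =
      mk⇔ (λ a≡b _ → avoids a≡b) (λ ⊥ᶠ-holds → ⊥-elim (⊥ᶠ-holds tt))
    residual-correct (¬ˢ φ) y xs av = ¬-cong-⇔ (residual-correct φ y xs av)
    residual-correct (φ ∧ˢ ψ) y xs av = let av₁ , av₂ = Allₚ.++⁻ (crossings φ) av in
      residual-correct φ y xs av₁ ×-⇔ residual-correct ψ y xs av₂
    residual-correct (φ ∨ˢ ψ) y xs av = let av₁ , av₂ = Allₚ.++⁻ (crossings φ) av in
      residual-correct φ y xs av₁ ⊎-⇔ residual-correct ψ y xs av₂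
    residual-correct (φ ⇒ˢ ψ) y xs av = let av₁ , av₂ = Allₚ.++⁻ (crossings φ) av in
      →-cong-⇔ (residual-correct φ y xs av₁) (residual-correct ψ y xs av₂)

-- The solutions of a crossing equation a(y) = b(x_i), where i = root b,
-- are the instances of y := b(z), x_i := a(z) (with z = b⁻¹(y)).

module _ {d K : ℕ} (a : Term d 1) (b : Term d K) where

  solveCrossing : Fin (suc K) → Term d K
  solveCrossing zero = b
  solveCrossing (suc j) with j Finₚ.≟ root b
  ... | yes _ = substTerm (const (var j)) a
  ... | no _  = var j

  solveCrossing-covers : ∀ {s m} (p : Picture d s m) (ρ : Env d m (suc K)) →
                         evalT p (const (ρ zero)) a ≡ evalT p (ρ ∘ suc) b →
                         ∃[ ζ ] ∀ j → evalT p ζ (solveCrossing j) ≡ ρ j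
  solveCrossing-covers {m = m} p ρ a≡b = ζ , solves
    where
    open ≡-Reasoning
    z : Point d m
    z = ⟦ b ⟧ᵗ⁻¹ (ρ zero)

    ζ : Env d m K
    ζ = Env.updateAt (ρ ∘ suc) (root b) (const z)

    solves : ∀ j → evalT p ζ (solveCrossing j) ≡ ρ j
    solves zero = begin
      evalT p ζ b           ≡⟨ evalT-⟦⟧ᵗ p ζ b ⟩
      ⟦ b ⟧ᵗ (ζ (root b))   ≡⟨ cong ⟦ b ⟧ᵗ (Envₚ.updateAt-updates (root b) (ρ ∘ suc)) ⟩
      ⟦ b ⟧ᵗ z              ≡⟨ ⟦⟧ᵗ-⟦⟧ᵗ⁻¹ b (ρ zero) ⟩
      ρ zero                ∎
    solves (suc j) with j Finₚ.≟ root b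
    ... | no j≢root = Envₚ.updateAt-minimal j (root b) (ρ ∘ suc) j≢root
    ... | yes refl  = begin
      evalT p ζ (substTerm (const (var j)) a) ≡⟨ evalT-substTerm p _ ζ a ⟩
      evalT p (const (ζ j)) a                 ≡⟨ evalT-⟦⟧ᵗ p _ a ⟩
      ⟦ a ⟧ᵗ (ζ j)                            ≡⟨ cong ⟦ a ⟧ᵗ (Envₚ.updateAt-updates j (ρ ∘ suc)) ⟩
      ⟦ a ⟧ᵗ z                                ≡⟨ ⟦⟧ᵗ-injective b (begin
        ⟦ b ⟧ᵗ (⟦ a ⟧ᵗ z)        ≡⟨ ⟦⟧ᵗ-comm b a z ⟩
        ⟦ a ⟧ᵗ (⟦ b ⟧ᵗ z)        ≡⟨ cong ⟦ a ⟧ᵗ (⟦⟧ᵗ-⟦⟧ᵗ⁻¹ b (ρ zero)) ⟩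
        ⟦ a ⟧ᵗ (ρ zero)          ≡⟨ evalT-⟦⟧ᵗ p (const (ρ zero)) a ⟨
        evalT p (const (ρ zero)) a ≡⟨ a≡b ⟩
        evalT p (ρ ∘ suc) b      ≡⟨ evalT-⟦⟧ᵗ p (ρ ∘ suc) b ⟩
        ⟦ b ⟧ᵗ (ρ (suc j))       ∎) ⟩
      ρ (suc j)                               ∎

points : ∀ d m → List (Point d m)
points zero    m = [] ∷ []
points (suc d) m = List.cartesianProductWith _∷_ (allFin (suc m)) (points d m)

∈-points : ∀ {d m} (x : Point d m) → x ∈ points d m
∈-points []      = here refl
∈-points (a ∷ x) = ∈-cartesianProductWith⁺ _∷_ (∈-allFin a) (∈-points x)

module _ {A : Set} where

  entry : List A → ℕ → Maybe A
  entry []       _       = nothing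
  entry (x ∷ _)  zero    = just x
  entry (_ ∷ xs) (suc n) = entry xs n

  entry-∈ : ∀ xs n {c} → entry xs n ≡ just c → c ∈ xs
  entry-∈ (x ∷ xs) zero    refl = here refl
  entry-∈ (x ∷ xs) (suc n) eq   = there (entry-∈ xs n eq)

  ∈⇒entry : ∀ {xs c} → c ∈ xs → ∃[ n ] n < List.length xs × entry xs n ≡ just c
  ∈⇒entry (here refl) = zero , s≤s z≤n , refl
  ∈⇒entry (there c∈xs) = let n , n< , eq = ∈⇒entry c∈xs in suc n , s≤s n< , eq

  unique-avoids : (_≟_ : DecidableEquality A) → ∀ {xs} → Unique xs → ∀ {E} (f : Fin E → A) →
                  E < List.length xs → ∃[ y ] y ∈ xs × ∀ e → y ≢ f e
  unique-avoids _≟_ {x ∷ xs} (x∉xs ∷ unique) f E<len with Finₚ.any? (λ e → x ≟ f e)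
  ... | no x-avoids = x , here refl , λ e x≡fe → x-avoids (e , x≡fe)
  unique-avoids _≟_ {x ∷ xs} (x∉xs ∷ unique) {suc E} f (s≤s E<len) | yes (e₀ , x≡fe₀) =
    let y , y∈xs , y-avoids = unique-avoids _≟_ unique (f ∘ Fin.punchIn e₀) E<len in
    y , there y∈xs , avoids y∈xs y-avoids
    where
    avoids : ∀ {y} → y ∈ xs → (∀ e → y ≢ f (Fin.punchIn e₀ e)) → ∀ e → y ≢ f e
    avoids y∈xs y-avoids e with e₀ Finₚ.≟ e
    ... | yes refl = λ y≡fe₀ → ListAll.lookup x∉xs y∈xs (trans x≡fe₀ (sym y≡fe₀))
    ... | no e₀≢e  = λ y≡fe → y-avoids (Fin.punchOut e₀≢e)
                       (trans y≡fe (cong f (sym (Finₚ.punchIn-punchOut e₀≢e))))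

-- Eliminating the first universal variable

module Step {d s k : ℕ} {U N : Set} (θ : Formula d s U N (suc (suc k))) where
  open Separation {d} {s} {U} {N} {k}

  φ : Separated
  φ = separate θ

  E : ℕ
  E = crossCount φ

  L : ℕ
  L = proj₁ (finiteYType φ)

  typeAt : Fin L → YType φ
  typeAt = Inverse.to (proj₂ (finiteYType φ))

  crossY : Fin E → Term d 1
  crossY e = proj₁ (lookup (crossings φ) e)

  crossX : Fin E → Term d K
  crossX e = proj₂ (lookup (crossings φ) e)

  -- For each y-type l and slot j < E: the slot, its certificate relations and
  -- its images under the a_e; the flags "l has more than E points" and
  -- "slot j of l is empty".
  Unary′ : Set
  Unary′ = U ⊎ (Fin L × Fin E × (GadgetSymbol d ⊎ Fin E))

  Nullary′ : Set
  Nullary′ = N ⊎ (Fin L ⊎ (Fin L × Fin E))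

  gadgetSym : Fin L → Fin E → GadgetSymbol d → Unary′
  gadgetSym l j g = inj₂ (l , j , inj₁ g)

  slot : Fin L → Fin E → Unary′
  slot l j = gadgetSym l j mark

  shifted : Fin L → Fin E → Fin E → Unary′
  shifted l j e = inj₂ (l , j , inj₂ e)

  crowded : Fin L → Nullary′
  crowded l = inj₂ (inj₁ l)

  vacant : Fin L → Fin E → Nullary′
  vacant l j = inj₂ (inj₂ (l , j))

  private
    x₀ : Term d K
    x₀ = var zero

  embed : Formula d s U N K → Formula d s Unary′ Nullary′ K
  embed = rename inj₁ inj₁

  crossingInstance : Fin E → Formula d s U N K
  crossingInstance e = substFormula (solveCrossing (crossY e) (crossX e)) θ

  crossingInstances : Formula d s Unary′ Nullary′ K
  crossingInstances = ⋀ E λ e → embed (crossingInstance e)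

  -- some point of type l satisfies none of the crossing equations with xs
  typeAvoids : Fin L → Formula d s Unary′ Nullary′ K
  typeAvoids l = nullary (crowded l) ∨ᶠ
    ⋁ E λ j → ¬ᶠ nullary (vacant l j) ∧ᶠ ⋀ E λ e → ¬ᶠ unary (shifted l j e) (crossX e)

  residuals : Formula d s Unary′ Nullary′ K
  residuals = ⋀ L λ l → typeAvoids l ⇒ᶠ embed (residual φ (typeAt l))

  slotsCover : Formula d s Unary′ Nullary′ K
  slotsCover = ⋀ L λ l → embed (hasType φ (typeAt l)) ⇒ᶠ
    nullary (crowded l) ∨ᶠ ⋁ E λ j → unary (slot l j) x₀

  vacantSlots : Formula d s Unary′ Nullary′ K
  vacantSlots = ⋀ L λ l → ⋀ E λ j → nullary (vacant l j) ⇒ᶠ ¬ᶠ unary (slot l j) x₀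

  shiftedSlots : Formula d s Unary′ Nullary′ K
  shiftedSlots = ⋀ L λ l → ⋀ E λ j → ⋀ E λ e →
    unary (shifted l j e) (substTerm (const x₀) (crossY e)) ⇔ᶠ unary (slot l j) x₀

  singletonSlots : Formula d s Unary′ Nullary′ K
  singletonSlots = ⋀ L λ l → ⋀ E λ j → rename (gadgetSym l j) ⊥-elim singletonGadget

  eliminated : Formula d s Unary′ Nullary′ K
  eliminated =
    crossingInstances ∧ᶠ residuals ∧ᶠ slotsCover ∧ᶠ vacantSlots ∧ᶠ shiftedSlots ∧ᶠ singletonSlots

  module _ {m : ℕ} (p : Picture d s m) where

    evalT-atX₀ : (ρ : Env d m K) (a : Term d 1) → evalT p ρ (substTerm (const x₀) a) ≡ ⟦ a ⟧ᵗ (ρ zero)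
    evalT-atX₀ ρ a = trans (evalT-substTerm p _ ρ a) (evalT-⟦⟧ᵗ p _ a)

    module Embedding (R₁′ : Unary′ → Point d m → Bool) (R₀′ : Nullary′ → Bool) {ρ : Env d m K}
                     (ψ : Formula d s U N K) where
      private
        ⊨ᶠ-embed = ⊨ᶠ-rename p inj₁ inj₁ R₁′ R₀′ ρ ψ

      embed⁺ : Semantics._⊨ᶠ_ p (R₁′ ∘ inj₁) (R₀′ ∘ inj₁) ρ ψ → Semantics._⊨ᶠ_ p R₁′ R₀′ ρ (embed ψ)
      embed⁺ = subst id (sym ⊨ᶠ-embed)

      embed⁻ : Semantics._⊨ᶠ_ p R₁′ R₀′ ρ (embed ψ) → Semantics._⊨ᶠ_ p (R₁′ ∘ inj₁) (R₀′ ∘ inj₁) ρ ψ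
      embed⁻ = subst id ⊨ᶠ-embed

    module Sound (R₁′ : Unary′ → Point d m → Bool) (R₀′ : Nullary′ → Bool)
                 (holds : ∀ ρ → Semantics._⊨ᶠ_ p R₁′ R₀′ ρ eliminated) where
      private
        module New = Semantics p R₁′ R₀′
        R₁ = R₁′ ∘ inj₁
        R₀ = R₀′ ∘ inj₁
      open Semantics p R₁ R₀
      open Embedding R₁′ R₀′

      instances : ∀ ζ e → ζ ⊨ᶠ crossingInstance e
      instances ζ e = let I , _ = holds ζ in embed⁻ (crossingInstance e) (New.⊨ᶠ-⋀⁻ E I e)

      residual-holds : ∀ xs l → xs New.⊨ᶠ typeAvoids l → xs ⊨ᶠ residual φ (typeAt l)
      residual-holds xs l avoids = let _ , Res , _ = holds xs in
        embed⁻ (residual φ (typeAt l)) (New.⊨ᶠ-⋀⁻ L Res l avoids)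

      covered : ∀ y l → const y ⊨ᶠ hasType φ (typeAt l) →
                T (R₀′ (crowded l)) ⊎ ∃[ j ] T (R₁′ (slot l j) y)
      covered y l y-has-type = let _ , _ , Cov , _ = holds (const y) in
        Sum.map₂ (New.⊨ᶠ-⋁⁻ E) (New.⊨ᶠ-⋀⁻ L Cov l (embed⁺ (hasType φ (typeAt l)) y-has-type))

      vacant-unmarked : ∀ x l j → T (R₀′ (vacant l j)) → ¬ T (R₁′ (slot l j) x)
      vacant-unmarked x l j = let _ , _ , _ , Vac , _ = holds (const x) in
        New.⊨ᶠ-⋀⁻ E (New.⊨ᶠ-⋀⁻ L Vac l) j

      shifted⇒slot : ∀ x l j e → T (R₁′ (shifted l j e) (⟦ crossY e ⟧ᵗ x)) → T (R₁′ (slot l j) x)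
      shifted⇒slot x l j e shift = let _ , _ , _ , _ , Shf , _ = holds (const x) in
        proj₁ (New.⊨ᶠ-⋀⁻ E (New.⊨ᶠ-⋀⁻ E (New.⊨ᶠ-⋀⁻ L Shf l) j) e)
          (subst (T ∘ R₁′ (shifted l j e)) (sym (evalT-atX₀ (const x) (crossY e))) shift)

      slot-singleton : ∀ l j {a b} → T (R₁′ (slot l j) a) → T (R₁′ (slot l j) b) → a ≡ b
      slot-singleton l j = certificate-unique (gadget⇒certificate p (R₁′ ∘ gadgetSym l j) gadget-holds)
        where
        gadget-holds : ∀ ρ → Semantics._⊨ᶠ_ p (R₁′ ∘ gadgetSym l j) (R₀′ ∘ ⊥-elim) ρ singletonGadget
        gadget-holds ρ = let _ , _ , _ , _ , _ , Sng = holds ρ in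
          subst id (⊨ᶠ-rename p (gadgetSym l j) ⊥-elim R₁′ R₀′ ρ singletonGadget)
            (New.⊨ᶠ-⋀⁻ E (New.⊨ᶠ-⋀⁻ L Sng l) j)

      at-crossing : ∀ ρ e → evalT p (const (ρ zero)) (crossY e) ≡ evalT p (ρ ∘ suc) (crossX e) → ρ ⊨ᶠ θ
      at-crossing ρ e a≡b =
        let ζ , solves = solveCrossing-covers (crossY e) (crossX e) p ρ a≡b in
        subst id (trans (⊨ᶠ-substFormula p R₁ R₀ _ ζ θ) (⊨ᶠ-cong-env p R₁ R₀ solves θ)) (instances ζ e)

      off-crossings : ∀ ρ → All (Avoids p (ρ zero) (ρ ∘ suc)) (crossings φ) → ρ ⊨ᶠ θ
      off-crossings ρ avoids =
        Equivalence.from (separate-correct p R₁ R₀ ρ θ)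
          (Equivalence.from (residual-correct p R₁ R₀ φ y xs avoids)
            (subst (λ σ → xs ⊨ᶠ residual φ σ) l-is-type (residual-holds xs l type-avoids)))
        where
        y = ρ zero
        xs = ρ ∘ suc
        l : Fin L
        l = Inverse.from (proj₂ (finiteYType φ)) (typeOf p R₁ R₀ φ y)
        l-is-type : typeAt l ≡ typeOf p R₁ R₀ φ y
        l-is-type = Inverse.strictlyInverseˡ (proj₂ (finiteYType φ)) _

        -- a point sharing a slot with y is y, which crosses xs nowhere
        unshifted : ∀ j → T (R₁′ (slot l j) y) → ∀ e → ¬ T (R₁′ (shifted l j e) (evalT p xs (crossX e)))
        unshifted j y∈slot e shift = Allₚ.lookup⁺ avoids e (begin
          evalT p (const y) (crossY e) ≡⟨ evalT-⟦⟧ᵗ p _ (crossY e) ⟩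
          ⟦ crossY e ⟧ᵗ y              ≡⟨ cong ⟦ crossY e ⟧ᵗ (slot-singleton l j y∈slot c∈slot) ⟩
          ⟦ crossY e ⟧ᵗ c              ≡⟨ ⟦⟧ᵗ-⟦⟧ᵗ⁻¹ (crossY e) _ ⟩
          evalT p xs (crossX e)        ∎)
          where
          open ≡-Reasoning
          c = ⟦ crossY e ⟧ᵗ⁻¹ (evalT p xs (crossX e))
          c∈slot : T (R₁′ (slot l j) c)
          c∈slot = shifted⇒slot c l j e
            (subst (T ∘ R₁′ (shifted l j e)) (sym (⟦⟧ᵗ-⟦⟧ᵗ⁻¹ (crossY e) _)) shift)

        type-avoids : xs New.⊨ᶠ typeAvoids l
        type-avoids with covered y l (subst (λ σ → const y ⊨ᶠ hasType φ σ) (sym l-is-type)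
                                         (hasType-typeOf p R₁ R₀ φ (const y)))
        ... | inj₁ crowd        = inj₁ crowd
        ... | inj₂ (j , y∈slot) = inj₂ (New.⊨ᶠ-⋁⁺ E j
                (  (λ vac → vacant-unmarked y l j vac y∈slot)
                 , New.⊨ᶠ-⋀⁺ E (unshifted j y∈slot)))

      sound : ∀ ρ → ρ ⊨ᶠ θ
      sound ρ with Finₚ.any? (λ e → evalT p (const (ρ zero)) (crossY e) ≟ᵖ evalT p (ρ ∘ suc) (crossX e))
      ... | yes (e , a≡b) = at-crossing ρ e a≡b
      ... | no none       = off-crossings ρ (Allₚ.lookup⁻ λ e a≡b → none (e , a≡b))

    module Complete (R₁ : U → Point d m → Bool) (R₀ : N → Bool)
                    (holds : ∀ ρ → Semantics._⊨ᶠ_ p R₁ R₀ ρ θ) where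
      open Semantics p R₁ R₀

      hasType? : ∀ l y → Dec (const y ⊨ᶠ hasType φ (typeAt l))
      hasType? l y = ⊨ᶠ-dec (const y) (hasType φ (typeAt l))

      class : Fin L → List (Point d m)
      class l = List.deduplicate _≟ᵖ_ (List.filter (hasType? l) (points d m))

      class-type : ∀ {l c} → c ∈ class l → typeOf p R₁ R₀ φ c ≡ typeAt l
      class-type {l} c∈class = hasType⇒typeOf p R₁ R₀ φ (typeAt l) (const _)
        (proj₂ (∈-filter⁻ (hasType? l) {xs = points d m} (∈-deduplicate⁻ _≟ᵖ_ _ c∈class)))

      ∈-class : ∀ {l} y → const y ⊨ᶠ hasType φ (typeAt l) → y ∈ class l
      ∈-class {l} y y-has-type = ∈-deduplicate⁺ _≟ᵖ_ (∈-filter⁺ (hasType? l) (∈-points y) y-has-type)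

      isCrowded : ∀ l → Dec (E < List.length (class l))
      isCrowded l = E ℕ.<? List.length (class l)

      slotContent : Fin L → Fin E → Maybe (Point d m)
      slotContent l j with isCrowded l
      ... | yes _ = nothing
      ... | no _  = entry (class l) (toℕ j)

      slotContent-∈ : ∀ l j {c} → slotContent l j ≡ just c → c ∈ class l
      slotContent-∈ l j eq with isCrowded l
      ... | no _ = entry-∈ (class l) (toℕ j) eq

      slotContent-uncrowded : ∀ l j → ¬ E < List.length (class l) →
                              slotContent l j ≡ entry (class l) (toℕ j)
      slotContent-uncrowded l j uncrowded with isCrowded l
      ... | yes crowd = contradiction crowd uncrowded
      ... | no _      = refl

      R₁′ : Unary′ → Point d m → Bool
      R₁′ (inj₁ r)                = R₁ r
      R₁′ (inj₂ (l , j , inj₁ g)) = certificateRelations (slotContent l j) g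
      R₁′ (inj₂ (l , j , inj₂ e)) = marks (slotContent l j) ∘ ⟦ crossY e ⟧ᵗ⁻¹

      R₀′ : Nullary′ → Bool
      R₀′ (inj₁ r)              = R₀ r
      R₀′ (inj₂ (inj₁ l))       = ⌊ isCrowded l ⌋
      R₀′ (inj₂ (inj₂ (l , j))) = is-nothing (slotContent l j)

      private
        module New = Semantics p R₁′ R₀′
      open Embedding R₁′ R₀′

      residual-witness : ∀ xs l {c} → c ∈ class l → All (Avoids p c xs) (crossings φ) →
                         xs ⊨ᶠ residual φ (typeAt l)
      residual-witness xs l {c} c∈class avoids =
        subst (λ σ → xs ⊨ᶠ residual φ σ) (class-type c∈class)
          (Equivalence.to (residual-correct p R₁ R₀ φ c xs avoids)
            (Equivalence.to (separate-correct p R₁ R₀ (c Env.∷ xs) θ) (holds (c Env.∷ xs))))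

      residual-holds : ∀ xs l → xs New.⊨ᶠ typeAvoids l → xs ⊨ᶠ residual φ (typeAt l)
      residual-holds xs l (inj₁ crowd) =
        let c , c∈class , c-avoids =
              unique-avoids _≟ᵖ_ (deduplicate-! _≟ᵖ_ _) forbidden (toWitness crowd)
        in residual-witness xs l c∈class (Allₚ.lookup⁻ λ e a≡b →
             c-avoids e (evalT-const-⟦⟧ᵗ⁻¹ p (crossY e) a≡b))
        where
        forbidden : Fin E → Point d m
        forbidden e = ⟦ crossY e ⟧ᵗ⁻¹ (evalT p xs (crossX e))
      residual-holds xs l (inj₂ some-slot) =
        let j , occupied , unshifted = New.⊨ᶠ-⋁⁻ E some-slot
            c , content = occupied⇒just (slotContent l j) occupied
        in residual-witness xs l (slotContent-∈ l j content) (Allₚ.lookup⁻ λ e a≡b →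
             New.⊨ᶠ-⋀⁻ E unshifted e (subst (λ o → T (marks o _)) (sym content)
               (fromWitness (cong just (evalT-const-⟦⟧ᵗ⁻¹ p (crossY e) a≡b)))))
        where
        occupied⇒just : ∀ (o : Maybe (Point d m)) → ¬ T (is-nothing o) → ∃[ c ] o ≡ just c
        occupied⇒just nothing  occupied = ⊥-elim (occupied tt)
        occupied⇒just (just c) _        = c , refl

      covers : ∀ ρ l → ρ ⊨ᶠ hasType φ (typeAt l) →
               ρ New.⊨ᶠ nullary (crowded l) ∨ᶠ ⋁ E (λ j → unary (slot l j) x₀)
      covers ρ l has-type with isCrowded l
      ... | yes _        = inj₁ tt
      ... | no uncrowded =
        let n , n<len , entry≡y = ∈⇒entry y∈class
            j = fromℕ< (ℕₚ.<-≤-trans n<len (ℕₚ.≮⇒≥ uncrowded))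
            content : slotContent l j ≡ just y
            content = trans (slotContent-uncrowded l j uncrowded)
                        (trans (cong (entry (class l)) (Finₚ.toℕ-fromℕ< _)) entry≡y)
        in inj₂ (New.⊨ᶠ-⋁⁺ E j (subst (λ o → T (marks o y)) (sym content) (fromWitness refl)))
        where
        y = ρ zero
        y∈class : y ∈ class l
        y∈class = ∈-class y (subst (λ σ → const y ⊨ᶠ hasType φ σ)
                              (hasType⇒typeOf p R₁ R₀ φ (typeAt l) ρ has-type)
                              (hasType-typeOf p R₁ R₀ φ (const y)))

      vacant-unmarked : ∀ o (x : Point d m) → T (is-nothing o) → ¬ T (marks o x)
      vacant-unmarked nothing  x _ ()
      vacant-unmarked (just c) x ()

      shifted-slot : ∀ ρ l j e →
        ρ New.⊨ᶠ unary (shifted l j e) (substTerm (const x₀) (crossY e)) ⇔ᶠ unary (slot l j) x₀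
      shifted-slot ρ l j e = subst (T ∘ marks (slotContent l j)) unshift
                           , subst (T ∘ marks (slotContent l j)) (sym unshift)
        where
        unshift : ⟦ crossY e ⟧ᵗ⁻¹ (evalT p ρ (substTerm (const x₀) (crossY e))) ≡ ρ zero
        unshift = trans (cong ⟦ crossY e ⟧ᵗ⁻¹ (evalT-atX₀ ρ (crossY e))) (⟦⟧ᵗ⁻¹-⟦⟧ᵗ (crossY e) (ρ zero))

      complete : ∀ ρ → ρ New.⊨ᶠ eliminated
      complete ρ =
          New.⊨ᶠ-⋀⁺ E (λ e → embed⁺ (crossingInstance e)
            (subst id (sym (⊨ᶠ-substFormula p R₁ R₀ _ ρ θ)) (holds _)))
        , New.⊨ᶠ-⋀⁺ L (λ l → embed⁺ (residual φ (typeAt l)) ∘ residual-holds ρ l)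
        , New.⊨ᶠ-⋀⁺ L (λ l → covers ρ l ∘ embed⁻ (hasType φ (typeAt l)))
        , New.⊨ᶠ-⋀⁺ L (λ l → New.⊨ᶠ-⋀⁺ E λ j → vacant-unmarked (slotContent l j) (ρ zero))
        , New.⊨ᶠ-⋀⁺ L (λ l → New.⊨ᶠ-⋀⁺ E λ j → New.⊨ᶠ-⋀⁺ E (shifted-slot ρ l j))
        , New.⊨ᶠ-⋀⁺ L (λ l → New.⊨ᶠ-⋀⁺ E λ j →
            subst id (sym (⊨ᶠ-rename p (gadgetSym l j) ⊥-elim R₁′ R₀′ ρ singletonGadget))
              (certificate⇒gadget p (R₁′ ∘ gadgetSym l j) (certificate-of (slotContent l j)) ρ))

stepSentence : ∀ {d s k} → UnarySentence d s (suc (suc k)) → UnarySentence d s (suc k)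
stepSentence {d} S = record
  { Unary = Unary′
  ; Nullary = Nullary′
  ; finiteUnary = finite-⊎ (finiteUnary S)
      (finite-× (finite-Fin L) (finite-× (finite-Fin E)
        (finite-⊎ (finite-GadgetSymbol d) (finite-Fin E))))
  ; finiteNullary = finite-⊎ (finiteNullary S)
      (finite-⊎ (finite-Fin L) (finite-× (finite-Fin L) (finite-Fin E)))
  ; matrix = eliminated }
  where open Step (matrix S)

step-correct : ∀ {d s m k} (p : Picture d s m) (S : UnarySentence d s (suc (suc k))) →
               (p ⊨ˢ S) ⇔ (p ⊨ˢ stepSentence S)
step-correct p S = mk⇔
  (λ (R₁ , R₀ , holds) → let open Complete p R₁ R₀ holds in R₁′ , R₀′ , complete)
  (λ (R₁′ , R₀′ , holds) → R₁′ ∘ inj₁ , R₀′ ∘ inj₁ , Sound.sound p R₁′ R₀′ holds)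
  where open Step (matrix S)

eliminateAll : ∀ {d s} k → UnarySentence d s (suc k) → UnarySentence d s 1
eliminateAll zero    S = S
eliminateAll (suc k) S = eliminateAll k (stepSentence S)

eliminateAll-correct : ∀ {d s m} k (p : Picture d s m) (S : UnarySentence d s (suc k)) →
                       (p ⊨ˢ S) ⇔ (p ⊨ˢ eliminateAll k S)
eliminateAll-correct zero    p S = ⇔-id _
eliminateAll-correct (suc k) p S = eliminateAll-correct k p (stepSentence S) ⇔-∘ step-correct p S

proposition2 : (d : ℕ) → 0 < d → (s : ℕ) → (Φ : ESO d s 1) →
    Σ (ESO∀ d s 1 1) λ Φ' →
      (m : ℕ) (p : Picture d s m) → (p ⊨ Φ) ⇔ (p ⊨∀ Φ')
proposition2 d _ s (suc k , _ , Φ) = toESO Ψ , λ m p →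
  toESO-correct p Ψ ⇔-∘ (eliminateAll-correct k p (fromESO Φ) ⇔-∘ fromESO-correct p Φ)
  where
  Ψ : UnarySentence d s 1
  Ψ = eliminateAll k (fromESO Φ)
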